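{- Let $G$ be a finite simple cubic graph with a 3-decomposition $(T,C,M)$, and colour exactly the edges of $T$ green (all other edges black). If $T$ is a HIST, then $M=\emptyset$. Otherwise, $G$ together with its 3-decomposition $(T,C,M)$ can be obtained by a single Tutte-extension or a single diamond-extension from a cubic graph $G'$ with fewer vertices than $G$ that has a 3-decomposition $(T',C,M')$ in which exactly the edges of $T'$ are green; here the green edges after the extension are exactly the edges of $T$, and the matching $M$ consists of $M'$ together with the black edges created by the extension. In particular, every 3-decomposition can be reduced to a 3-decomposition whose spanning tree is a HIST by a finite sequence of Tutte- and diamond-reductions.
   Context: All graphs are finite and simple. A 3-decomposition of a graph $G$ is a triple $(T,C,M)$ of subgraphs such that every edge of $G$ lies in exactly one of them, $T$ is a spanning tree of $G$, $C$ is a (possibly empty) 2-regular graph, and $M$ is a (possibly empty) matching. A HIST (homeomorphically irreducible spanning tree) is a spanning tree without vertices of degree 2. Consider graphs whose edges are coloured green or black, where the green edges form a spanning tree. A Tutte-extension: choose two distinct green edges $x_uy_u$ and $x_vy_v$ (they may share an end, e.g. $x_u=x_v$), subdivide them by new vertices $u$ and $v$ respectively (the four resulting edges $x_uu,uy_u,x_vv,vy_v$ are green), and add the black edge $uv$. A diamond-extension: choose a green edge $xy$, delete it, add new vertices $d_1,d_2,d_3,d_4$ with green edges $d_1d_3,d_3d_2,d_2d_4$ and black edges $d_1d_2,d_3d_4$ (so $d_1,\dots,d_4$ span a $K_4$ minus the edge $d_1d_4$), and add green edges $xd_1$ and $d_4y$. The inverse operations are called Tutte-reduction and diamond-reduction.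 -}

module Defs where

open import Data.Nat using (ℕ; zero; suc; _+_; _≤_; _<_)
open import Data.Bool using (Bool; true; false; if_then_else_)
open import Data.Fin using (Fin)
open import Data.List using (List; []; _∷_; length; allFin; _∷ʳ_)
open import Data.List.Relation.Unary.Linked using (Linked)
open import Data.List.Relation.Unary.Unique.Propositional using (Unique)
open import Data.Product using (Σ; ∃; ∃-syntax; _×_; _,_)
open import Data.Sum using (_⊎_)
open import Relation.Nullary using (¬_)
open import Relation.Binary.PropositionalEquality using (_≡_; _≢_)
open import Relation.Binary.Construct.Closure.ReflexiveTransitive using (Star)

-- A finite simple graph on the vertex set Fin n together with a
-- partition of its edges into three classes T, C, M is encoded by a
-- symmetric, irreflexive edge-labelling: `none` = non-edge,
-- `tr` = edge of T (green), `cy` = edge of C, `ma` = edge of M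
-- (C- and M-edges are black).

data Lab : Set where
  none tr cy ma : Lab

record DGraph (n : ℕ) : Set where
  field
    lab   : Fin n → Fin n → Lab
    sym   : ∀ u v → lab u v ≡ lab v u
    irref : ∀ u → lab u u ≡ none
open DGraph public

isEdge isT isC isM : Lab → Bool
isEdge none = false
isEdge _    = true
isT tr = true
isT _  = false
isC cy = true
isC _  = false
isM ma = true
isM _  = false

countL : ∀ {n} → (Fin n → Bool) → List (Fin n) → ℕ
countL f []       = 0
countL f (w ∷ ws) = (if f w then 1 else 0) + countL f ws

deg : ∀ {n} → DGraph n → (Lab → Bool) → Fin n → ℕ
deg {n} D p v = countL (λ w → p (lab D v w)) (allFin n)

TAdj : ∀ {n} → DGraph n → Fin n → Fin n → Set
TAdj D u v = lab D u v ≡ tr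

HasCycle : ∀ {n} → (Fin n → Fin n → Set) → Set
HasCycle {n} R = Σ (Fin n) λ x → Σ (List (Fin n)) λ ys →
  (2 ≤ length ys) × Unique (x ∷ ys) × Linked R ((x ∷ ys) ∷ʳ x)

SpanningTree : ∀ {n} → DGraph n → Set
SpanningTree {n} D =
  (∀ (u v : Fin n) → Star (TAdj D) u v) × ¬ HasCycle (TAdj D)

Cubic : ∀ {n} → DGraph n → Set
Cubic D = ∀ v → deg D isEdge v ≡ 3

ThreeDecomp : ∀ {n} → DGraph n → Set
ThreeDecomp D =
  SpanningTree D
  × (∀ v → deg D isC v ≡ 0 ⊎ deg D isC v ≡ 2)
  × (∀ v → deg D isM v ≤ 1)

HIST : ∀ {n} → DGraph n → Set
HIST D = SpanningTree D × (∀ v → deg D isT v ≢ 2)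

MEmpty : ∀ {n} → DGraph n → Set
MEmpty D = ∀ u v → lab D u v ≢ ma

-- Extensions, up to relabelling of vertices: φ embeds the old vertex
-- set Fin m into Fin n, the new vertices are exactly those outside the
-- image of φ.

Injective : ∀ {m n} → (Fin m → Fin n) → Set
Injective φ = ∀ a b → φ a ≡ φ b → a ≡ b

NotInImage : ∀ {m n} → (Fin m → Fin n) → Fin n → Set
NotInImage φ w = ∀ a → φ a ≢ w

InImage : ∀ {m n} → (Fin m → Fin n) → Fin n → Set
InImage φ w = ∃[ a ] φ a ≡ w

SameEdge : ∀ {m} → Fin m → Fin m → Fin m → Fin m → Set
SameEdge a b x y = (a ≡ x × b ≡ y) ⊎ (a ≡ y × b ≡ x)

-- D (on Fin n) arises from D' (on Fin m) by a Tutte-extension: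
-- green edges xu yu and xv yv of D' are subdivided by new vertices u, v
-- (all four new edges green), and the black edge uv is added to M;
-- all other labels are inherited from D'.
TutteExt : ∀ {m n} → DGraph m → DGraph n → Set
TutteExt {m} {n} D' D =
  Σ (Fin m → Fin n) λ φ → Σ (Fin n) λ u → Σ (Fin n) λ v →
  Σ (Fin m) λ xu → Σ (Fin m) λ yu → Σ (Fin m) λ xv → Σ (Fin m) λ yv →
    Injective φ
  × u ≢ v × NotInImage φ u × NotInImage φ v
  × (∀ w → InImage φ w ⊎ w ≡ u ⊎ w ≡ v)
  × lab D' xu yu ≡ tr × lab D' xv yv ≡ tr
  × ¬ SameEdge xu yu xv yv
  × (∀ a b → SameEdge a b xu yu ⊎ SameEdge a b xv yv
             → lab D (φ a) (φ b) ≡ none)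
  × (∀ a b → ¬ SameEdge a b xu yu → ¬ SameEdge a b xv yv
             → lab D (φ a) (φ b) ≡ lab D' a b)
  × lab D u v ≡ ma
  × (∀ a → (a ≡ xu ⊎ a ≡ yu) → lab D u (φ a) ≡ tr)
  × (∀ a → a ≢ xu → a ≢ yu → lab D u (φ a) ≡ none)
  × (∀ a → (a ≡ xv ⊎ a ≡ yv) → lab D v (φ a) ≡ tr)
  × (∀ a → a ≢ xv → a ≢ yv → lab D v (φ a) ≡ none)

-- D arises from D' by a diamond-extension on the green edge xy of D':
-- xy is deleted, new vertices d1..d4 with green edges d1d3, d3d2, d2d4,
-- black edges d1d2, d3d4 (added to M), d1d4 a non-edge, and green
-- edges x d1 and d4 y; all other labels are inherited from D'.
DiamondExt : ∀ {m n} → DGraph m → DGraph n → Set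
DiamondExt {m} {n} D' D =
  Σ (Fin m → Fin n) λ φ →
  Σ (Fin n) λ d1 → Σ (Fin n) λ d2 → Σ (Fin n) λ d3 → Σ (Fin n) λ d4 →
  Σ (Fin m) λ x → Σ (Fin m) λ y →
    Injective φ
  × d1 ≢ d2 × d1 ≢ d3 × d1 ≢ d4 × d2 ≢ d3 × d2 ≢ d4 × d3 ≢ d4
  × NotInImage φ d1 × NotInImage φ d2 × NotInImage φ d3 × NotInImage φ d4
  × (∀ w → InImage φ w ⊎ w ≡ d1 ⊎ w ≡ d2 ⊎ w ≡ d3 ⊎ w ≡ d4)
  × lab D' x y ≡ tr
  × (∀ a b → SameEdge a b x y → lab D (φ a) (φ b) ≡ none)
  × (∀ a b → ¬ SameEdge a b x y → lab D (φ a) (φ b) ≡ lab D' a b)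
  × lab D d1 d3 ≡ tr × lab D d3 d2 ≡ tr × lab D d2 d4 ≡ tr
  × lab D d1 d2 ≡ ma × lab D d3 d4 ≡ ma × lab D d1 d4 ≡ none
  × lab D (φ x) d1 ≡ tr × lab D d4 (φ y) ≡ tr
  × (∀ a → a ≢ x → lab D d1 (φ a) ≡ none)
  × (∀ a → lab D d2 (φ a) ≡ none)
  × (∀ a → lab D d3 (φ a) ≡ none)
  × (∀ a → a ≢ y → lab D d4 (φ a) ≡ none)

data ReducesToHIST : ∀ {n} → DGraph n → Set where
  done : ∀ {n} {D : DGraph n} → HIST D → ReducesToHIST D
  step : ∀ {m n} {D : DGraph n} (D' : DGraph m)
         → Cubic D' → ThreeDecomp D'
         → TutteExt D' D ⊎ DiamondExt D' D
         → ReducesToHIST D' → ReducesToHIST D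

{-# OPTIONS --safe #-}
-- Cubicity, the 2-regularity of C and the matching property leave a vertex only the (T, C, M)-degrees
-- (3,0,0), (2,0,1), (1,2,0) and (0,2,1); so a vertex with an M-edge has T-degree 2, whence M = ∅ for a HIST.
-- Otherwise some u has T-degree 2 and is matched to v, which has T-degree 2 as well. If neither u nor v
-- sees an edge between its two green neighbours, suppressing u and v is a Tutte-reduction. If the green
-- neighbours x, y of u are adjacent, then xy is an M-edge (a green edge closes a green triangle, a C-edge
-- would make {u, x, y} a component of T), and following the second green neighbours of x and y gives
-- a Tutte-reduction at x and y, or a diamond on u, v, x, y whose two outer neighbours admit either a
-- diamond-reduction or a Tutte-reduction. The reduced graph inherits all degrees;
-- it is connected because T retracts onto it, and acyclic because a cycle in it lifts to T by reinserting
-- the suppressed green paths. Well-founded recursion on the number of vertices then reaches a HIST.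
module Submission where

open import Defs hiding (sym)
open import Relation.Binary.Construct.Closure.ReflexiveTransitive using (Star; ε; _◅_; kleisliStar) renaming (reverse to Star-reverse)
open import Data.Bool using (Bool; true; false; if_then_else_; _∨_)
open import Data.Empty using (⊥; ⊥-elim)
open import Data.Fin using (Fin; zero; suc; punchIn; punchOut; _≟_)
open import Data.Fin.Properties using (punchIn-injective; punchInᵢ≢i; punchIn-punchOut; any?)
open import Data.List using (List; []; _∷_; length; _∷ʳ_; _++_; map; tabulate; initLast; _∷ʳ′_)
open import Data.Nat.ListAction using () renaming (sum to sumₗ)
open import Data.List.Membership.Propositional using (_∈_; _∉_)
open import Data.List.Relation.Unary.All using (All; []; _∷_)
import Data.List.Relation.Unary.All as All
open import Data.List.Relation.Unary.All.Properties using (All¬⇒¬Any; ∷ʳ⁺; ∷ʳ⁻) renaming (++⁺ to All-++⁺; map⁺ to All-map⁺)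
open import Data.List.Relation.Unary.Linked using (Linked; []; [-]; _∷_)
open import Data.List.Properties using (++-assoc; map-++; length-++; length-++-≤ˡ; length-map)
open import Data.List.Relation.Unary.Any using (here; there)
open import Data.List.Relation.Unary.Unique.Propositional using (Unique)
open import Data.List.Relation.Unary.Unique.Propositional.Properties using () renaming (map⁺ to Unique-map⁺)
open import Data.List.Relation.Unary.AllPairs using ([]; _∷_)
open import Data.Nat using (ℕ; zero; suc; _+_; _*_; _≤_; _<_; z≤n; s≤s; s≤s⁻¹) renaming (_≟_ to _≟ℕ_)
open import Data.Nat.Induction using (<-wellFounded)
open import Induction.WellFounded using (Acc; acc)
open import Data.Nat.Properties
  using (+-*-semiring; +-commutativeSemigroup; +-comm; +-assoc; +-identityʳ; *-distribʳ-+; m≤n+m; ≤-trans; ≤-reflexive; suc-injective)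
open import Algebra.Properties.Semiring.Sum +-*-semiring using (sum; sum-cong-≗; sum-remove; sum-replicate-zero; ∑-distrib-+; *-distribʳ-sum)
open import Algebra.Properties.CommutativeSemigroup +-commutativeSemigroup using (x∙yz≈yx∙z)
open import Data.Product using (Σ; ∃; _×_; _,_; proj₁; proj₂)
open import Data.Sum using (_⊎_; inj₁; inj₂; [_,_]′; map₂)
open import Data.Unit using (⊤; tt)
open import Function using (_∘_; id; flip)
open import Relation.Binary.PropositionalEquality
open import Relation.Nullary using (¬_; Dec; yes; no; does; contradiction)
open import Relation.Nullary.Decidable using (dec-true; dec-false)

toℕ : Bool → ℕ
toℕ b = if b then 1 else 0

count : ∀ {n} → (Fin n → Bool) → ℕ
count f = sum (toℕ ∘ f)

countL-tabulate : ∀ {n k} (f : Fin n → Bool) (g : Fin k → Fin n) → countL f (tabulate g) ≡ count (f ∘ g)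
countL-tabulate {k = zero}  f g = refl
countL-tabulate {k = suc k} f g = cong (toℕ (f (g zero)) +_) (countL-tabulate f (g ∘ suc))

deg≡count : ∀ {n} (D : DGraph n) p v → deg D p v ≡ count (λ w → p (lab D v w))
deg≡count D p v = countL-tabulate (λ w → p (lab D v w)) id

count≡0⇒false : ∀ {n} (f : Fin n → Bool) → count f ≡ 0 → ∀ w → f w ≡ false
count≡0⇒false {suc n} f c≡0 zero    with f zero
... | false = refl
count≡0⇒false {suc n} f c≡0 (suc w) with f zero
... | false = count≡0⇒false (f ∘ suc) c≡0 w

1≤count : ∀ {n} (f : Fin n → Bool) w → f w ≡ true → 1 ≤ count f
1≤count {suc n} f zero    fw with f zero
... | true = s≤s z≤n
1≤count {suc n} f (suc w) fw = ≤-trans (1≤count (f ∘ suc) w fw) (m≤n+m _ (toℕ (f zero)))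

count≤1⇒unique : ∀ {n} (f : Fin n → Bool) → count f ≤ 1 → ∀ {a b} → f a ≡ true → f b ≡ true → a ≡ b
count≤1⇒unique f c≤1 {zero}  {zero}  fa fb = refl
count≤1⇒unique f c≤1 {zero}  {suc b} fa fb = contradiction (≤-trans (1≤count (f ∘ suc) b fb) (rest≤0 f fa c≤1)) λ ()
  where
  rest≤0 : ∀ {k} (g : Fin (suc k) → Bool) → g zero ≡ true → count g ≤ 1 → count (g ∘ suc) ≤ 0
  rest≤0 g g0 c rewrite g0 = s≤s⁻¹ c
count≤1⇒unique f c≤1 {suc a} {zero}  fa fb = sym (count≤1⇒unique f c≤1 fb fa)
count≤1⇒unique f c≤1 {suc a} {suc b} fa fb =
  cong suc (count≤1⇒unique (f ∘ suc) (≤-trans (m≤n+m _ (toℕ (f zero))) c≤1) fa fb)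

punchIn-surjective : ∀ {k} (i w : Fin (suc k)) → w ≢ i → ∃ λ w' → punchIn i w' ≡ w
punchIn-surjective i w w≢i = punchOut (≢-sym w≢i) , punchIn-punchOut (≢-sym w≢i)

count≢0⇒true : ∀ {n} (f : Fin n → Bool) → count f ≢ 0 → ∃ λ a → f a ≡ true
count≢0⇒true {zero}  f c≢0 = contradiction refl c≢0
count≢0⇒true {suc n} f c≢0 with f zero in f0
... | true  = zero , f0
... | false = let a , fa = count≢0⇒true (f ∘ suc) c≢0 in suc a , fa

count-punchIn : ∀ {n} (f : Fin (suc n) → Bool) {a} → f a ≡ true → count f ≡ suc (count (f ∘ punchIn a))
count-punchIn f {a} fa = trans (sum-remove {i = a} (toℕ ∘ f)) (cong (λ b → toℕ b + count (f ∘ punchIn a)) fa)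

count≡suc⇒true : ∀ {n k} (f : Fin n → Bool) → count f ≡ suc k → ∃ λ a → f a ≡ true
count≡suc⇒true f c≡suc = count≢0⇒true f (λ c≡0 → contradiction (trans (sym c≡suc) c≡0) λ ())

count≡1⇒unique : ∀ {n} (f : Fin n → Bool) → count f ≡ 1 →
  Σ (Fin n) λ a → f a ≡ true × (∀ w → f w ≡ true → w ≡ a)
count≡1⇒unique f c≡1 =
  let a , fa = count≡suc⇒true f c≡1 in a , fa , λ w fw → count≤1⇒unique f (≤-reflexive c≡1) fw fa

count≡2⇒pair : ∀ {n} (f : Fin n → Bool) → count f ≡ 2 →
  Σ (Fin n) λ a → Σ (Fin n) λ b → a ≢ b × f a ≡ true × f b ≡ true × (∀ w → f w ≡ true → w ≡ a ⊎ w ≡ b)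
count≡2⇒pair {zero}  f ()
count≡2⇒pair {suc n} f c≡2 = let a , fa = count≡suc⇒true f c≡2 in pair-through a fa
  where
  pair-through : ∀ a → f a ≡ true →
    Σ (Fin (suc n)) λ a → Σ (Fin (suc n)) λ b → a ≢ b × f a ≡ true × f b ≡ true × (∀ w → f w ≡ true → w ≡ a ⊎ w ≡ b)
  pair-through a fa = a , punchIn a b , ≢-sym (punchInᵢ≢i a b) , fa , fb , exhaustive
    where
    rest = count≡1⇒unique (f ∘ punchIn a) (suc-injective (trans (sym (count-punchIn f fa)) c≡2))
    b = proj₁ rest
    fb = proj₁ (proj₂ rest)
    exhaustive : ∀ w → f w ≡ true → w ≡ a ⊎ w ≡ punchIn a b
    exhaustive w fw with w ≟ a
    ... | yes w≡a = inj₁ w≡a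
    ... | no  w≢a = let w' , w'≡w = punchIn-surjective a w w≢a
                    in inj₂ (trans (sym w'≡w) (cong (punchIn a) (proj₂ (proj₂ rest) w' (trans (cong f w'≡w) fw))))

toℕ-isEdge : ∀ l → toℕ (isEdge l) ≡ toℕ (isT l) + toℕ (isC l) + toℕ (isM l)
toℕ-isEdge none = refl
toℕ-isEdge tr   = refl
toℕ-isEdge cy   = refl
toℕ-isEdge ma   = refl

deg≡degT+degC+degM : ∀ {n} (D : DGraph n) v → deg D isEdge v ≡ deg D isT v + deg D isC v + deg D isM v
deg≡degT+degC+degM D v = begin
  deg D isEdge v                    ≡⟨ deg≡count D isEdge v ⟩
  count (isEdge ∘ lab D v)          ≡⟨ sum-cong-≗ (toℕ-isEdge ∘ lab D v) ⟩
  sum (λ w → T w + C w + M w)       ≡⟨ ∑-distrib-+ (λ w → T w + C w) M ⟩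
  sum (λ w → T w + C w) + sum M     ≡⟨ cong (_+ sum M) (∑-distrib-+ T C) ⟩
  sum T + sum C + sum M             ≡⟨ sym (cong₂ _+_ (cong₂ _+_ (deg≡count D isT v) (deg≡count D isC v)) (deg≡count D isM v)) ⟩
  deg D isT v + deg D isC v + deg D isM v ∎
  where
  open ≡-Reasoning
  T C M : Fin _ → ℕ
  T = toℕ ∘ isT ∘ lab D v
  C = toℕ ∘ isC ∘ lab D v
  M = toℕ ∘ isM ∘ lab D v

record Embedding (m n : ℕ) : Set where
  field
    φ         : Fin m → Fin n
    injective : Injective φ
    removed   : List (Fin n)
    removed-∉ : All (NotInImage φ) removed
    covers    : ∀ w → InImage φ w ⊎ w ∈ removed
    sum-split : ∀ h → sum h ≡ sumₗ (map h removed) + sum (h ∘ φ)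

id-embedding : ∀ n → Embedding n n
id-embedding n = record
  { φ = id ; injective = λ _ _ → id ; removed = [] ; removed-∉ = []
  ; covers = λ w → inj₁ (w , refl) ; sum-split = λ _ → refl }

skip : ∀ {m n} → Embedding (suc m) n → Fin (suc m) → Embedding m n
skip E a = record
  { φ         = φ ∘ punchIn a
  ; injective = λ b c e → punchIn-injective a b c (injective _ _ e)
  ; removed   = φ a ∷ removed
  ; removed-∉ = (λ b e → punchInᵢ≢i a b (injective _ _ e)) ∷ All.map (λ ∉φ b → ∉φ (punchIn a b)) removed-∉
  ; covers    = covers′
  ; sum-split = sum-split′
  }
  where
  open Embedding E
  covers′ : ∀ w → InImage (φ ∘ punchIn a) w ⊎ w ∈ φ a ∷ removed
  covers′ w with covers w
  ... | inj₂ w∈ = inj₂ (there w∈)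
  ... | inj₁ (b , φb≡w) with b ≟ a
  ...   | yes refl = inj₂ (here (sym φb≡w))
  ...   | no  b≢a  = let b' , b'↦b = punchIn-surjective a b b≢a in inj₁ (b' , trans (cong φ b'↦b) φb≡w)
  sum-split′ : ∀ h → sum h ≡ sumₗ (map h (φ a ∷ removed)) + sum (h ∘ φ ∘ punchIn a)
  sum-split′ h = begin
    sum h                                                 ≡⟨ sum-split h ⟩
    sumₗ (map h removed) + sum (h ∘ φ)                ≡⟨ cong (sumₗ (map h removed) +_) (sum-remove {i = a} (h ∘ φ)) ⟩
    sumₗ (map h removed) + (h (φ a) + sum (h ∘ φ ∘ punchIn a)) ≡⟨ x∙yz≈yx∙z (sumₗ (map h removed)) (h (φ a)) _ ⟩
    h (φ a) + sumₗ (map h removed) + sum (h ∘ φ ∘ punchIn a) ∎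
    where open ≡-Reasoning

skip-vertex : ∀ {m n} (E : Embedding m n) r → r ∉ Embedding.removed E →
  Σ ℕ λ m' → Σ (Embedding m' n) λ E' → Embedding.removed E' ≡ r ∷ Embedding.removed E
skip-vertex {zero} E r r∉ with Embedding.covers E r
... | inj₁ (() , _)
... | inj₂ r∈ = contradiction r∈ r∉
skip-vertex {suc m} E r r∉ with Embedding.covers E r
... | inj₁ (a , refl) = m , skip E a , refl
... | inj₂ r∈ = contradiction r∈ r∉

remove-all : ∀ {n} (rs : List (Fin n)) → Unique rs →
  Σ ℕ λ m → Σ (Embedding m n) λ E → Embedding.removed E ≡ rs
remove-all {n} [] _ = n , id-embedding n , refl
remove-all (r ∷ rs) (r∉rs ∷ unique) =
  let m , E , removed≡rs = remove-all rs unique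
      m' , E' , removed'≡ = skip-vertex E r (All¬⇒¬Any (subst (All (r ≢_)) (sym removed≡rs) r∉rs))
  in m' , E' , trans removed'≡ (cong (r ∷_) removed≡rs)

size-embedding : ∀ {m n} (E : Embedding m n) → n ≡ length (Embedding.removed E) + m
size-embedding {m} {n} E = begin
  n                                     ≡⟨ sym (sum-const n) ⟩
  sum {n} (λ _ → 1)                     ≡⟨ Embedding.sum-split E (λ _ → 1) ⟩
  sumₗ (map (λ _ → 1) removed) + sum {m} (λ _ → 1) ≡⟨ cong₂ _+_ (sum-map-const removed) (sum-const m) ⟩
  length removed + m                    ∎
  where
  open ≡-Reasoning
  open Embedding E using (removed)
  sum-const : ∀ k → sum {k} (λ _ → 1) ≡ k
  sum-const zero    = refl
  sum-const (suc k) = cong suc (sum-const k)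
  sum-map-const : ∀ (rs : List (Fin n)) → sumₗ (map (λ _ → 1) rs) ≡ length rs
  sum-map-const []       = refl
  sum-map-const (_ ∷ rs) = cong suc (sum-map-const rs)

module ReducedGraph {m n} (D : DGraph n) (E : Embedding m n)
  (added : Fin m → Fin m → Bool)
  (added-sym : ∀ a b → added a b ≡ added b a)
  (added-irrefl : ∀ a → added a a ≡ false) where
  open Embedding E

  labʳ : Fin m → Fin m → Lab
  labʳ a b = if added a b then tr else lab D (φ a) (φ b)

  reduced : DGraph m
  reduced = record { lab = labʳ ; sym = labʳ-sym ; irref = labʳ-irrefl }
    where
    labʳ-sym : ∀ a b → labʳ a b ≡ labʳ b a
    labʳ-sym a b rewrite added-sym a b with added b a
    ... | true  = refl
    ... | false = DGraph.sym D (φ a) (φ b)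
    labʳ-irrefl : ∀ a → labʳ a a ≡ none
    labʳ-irrefl a rewrite added-irrefl a = DGraph.irref D (φ a)

  labʳ-added : ∀ {a b} → added a b ≡ true → labʳ a b ≡ tr
  labʳ-added {a} {b} added-ab rewrite added-ab = refl

  labʳ-kept : ∀ {a b} → added a b ≡ false → labʳ a b ≡ lab D (φ a) (φ b)
  labʳ-kept {a} {b} ¬added-ab rewrite ¬added-ab = refl

  labʳ-green : ∀ {a b} → lab D (φ a) (φ b) ≡ tr → labʳ a b ≡ tr
  labʳ-green {a} {b} green with added a b
  ... | true  = refl
  ... | false = green

  reduced-T-sym : ∀ {a b} → TAdj reduced a b → TAdj reduced b a
  reduced-T-sym {a} {b} green = trans (DGraph.sym reduced b a) green

  -- A kept vertex trades its green edges into `removed` for equally many added green edges.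
  module Degrees
    (added⇒none    : ∀ a b → added a b ≡ true → lab D (φ a) (φ b) ≡ none)
    (removed-green : ∀ a → All (λ r → lab D (φ a) r ≡ none ⊎ lab D (φ a) r ≡ tr) removed)
    (removed-count : ∀ a → sumₗ (map (toℕ ∘ isEdge ∘ lab D (φ a)) removed) ≡ count (added a))
    where

    toℕ-labʳ : ∀ (p : Lab → Bool) → p none ≡ false → ∀ a b →
      toℕ (p (labʳ a b)) ≡ toℕ (added a b) * toℕ (p tr) + toℕ (p (lab D (φ a) (φ b)))
    toℕ-labʳ p p-none a b with added a b in added-ab
    ... | true  rewrite added⇒none a b added-ab | p-none = sym (trans (+-identityʳ _) (+-identityʳ _))
    ... | false = refl

    sum-removed : ∀ (p : Lab → Bool) → p none ≡ false → ∀ a rs →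
      All (λ r → lab D (φ a) r ≡ none ⊎ lab D (φ a) r ≡ tr) rs →
      sumₗ (map (toℕ ∘ p ∘ lab D (φ a)) rs) ≡ sumₗ (map (toℕ ∘ isEdge ∘ lab D (φ a)) rs) * toℕ (p tr)
    sum-removed p p-none a []       []       = refl
    sum-removed p p-none a (r ∷ rs) (g ∷ gs) =
      trans (cong₂ _+_ (one g) (sum-removed p p-none a rs gs))
            (sym (*-distribʳ-+ (toℕ (p tr)) (toℕ (isEdge (lab D (φ a) r))) _))
      where
      one : lab D (φ a) r ≡ none ⊎ lab D (φ a) r ≡ tr →
        toℕ (p (lab D (φ a) r)) ≡ toℕ (isEdge (lab D (φ a) r)) * toℕ (p tr)
      one (inj₁ ≡none) rewrite ≡none | p-none = refl
      one (inj₂ ≡tr)   rewrite ≡tr = sym (+-identityʳ _)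

    deg-reduced : ∀ (p : Lab → Bool) → p none ≡ false → ∀ a → deg reduced p a ≡ deg D p (φ a)
    deg-reduced p p-none a = begin
      deg reduced p a                                              ≡⟨ deg≡count reduced p a ⟩
      count (p ∘ labʳ a)                                           ≡⟨ sum-cong-≗ (toℕ-labʳ p p-none a) ⟩
      sum (λ b → toℕ (added a b) * P + toℕ (p (lab D (φ a) (φ b)))) ≡⟨ ∑-distrib-+ (λ b → toℕ (added a b) * P) old ⟩
      sum (λ b → toℕ (added a b) * P) + sum old                    ≡⟨ cong (_+ sum old) (sym (*-distribʳ-sum P (toℕ ∘ added a))) ⟩
      count (added a) * P + sum old                                ≡⟨ cong (λ k → k * P + sum old) (sym (removed-count a)) ⟩
      sumₗ (map (toℕ ∘ isEdge ∘ lab D (φ a)) removed) * P + sum old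
        ≡⟨ cong (_+ sum old) (sym (sum-removed p p-none a removed (removed-green a))) ⟩
      sumₗ (map (toℕ ∘ p ∘ lab D (φ a)) removed) + sum old         ≡⟨ sym (sum-split (toℕ ∘ p ∘ lab D (φ a))) ⟩
      count (p ∘ lab D (φ a))                                      ≡⟨ sym (deg≡count D p (φ a)) ⟩
      deg D p (φ a)                                                ∎
      where
      open ≡-Reasoning
      P = toℕ (p tr)
      old = λ b → toℕ (p (lab D (φ a) (φ b)))

    reduced-cubic : Cubic D → Cubic reduced
    reduced-cubic cubic a = trans (deg-reduced isEdge refl a) (cubic (φ a))

    reduced-2-regular : (∀ v → deg D isC v ≡ 0 ⊎ deg D isC v ≡ 2) → ∀ a → deg reduced isC a ≡ 0 ⊎ deg reduced isC a ≡ 2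
    reduced-2-regular C-2-regular a rewrite deg-reduced isC refl a = C-2-regular (φ a)

    reduced-matching : (∀ v → deg D isM v ≤ 1) → ∀ a → deg reduced isM a ≤ 1
    reduced-matching M-matching a rewrite deg-reduced isM refl a = M-matching (φ a)

module _ {A : Set} {R : A → A → Set} where

  linked-∷ʳ : ∀ xs z d → Linked R (xs ∷ʳ z) → R z d → Linked R ((xs ∷ʳ z) ∷ʳ d)
  linked-∷ʳ []           z d l         r = r ∷ [-]
  linked-∷ʳ (x ∷ [])     z d (h ∷ l)   r = h ∷ linked-∷ʳ [] z d l r
  linked-∷ʳ (x ∷ y ∷ xs) z d (h ∷ l)   r = h ∷ linked-∷ʳ (y ∷ xs) z d l r

  linked-join : ∀ xs z ys → Linked R (xs ∷ʳ z) → Linked R (z ∷ ys) → Linked R (xs ++ z ∷ ys)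
  linked-join []           z ys l₁       l₂ = l₂
  linked-join (x ∷ [])     z ys (h ∷ l₁) l₂ = h ∷ l₂
  linked-join (x ∷ y ∷ xs) z ys (h ∷ l₁) l₂ = h ∷ linked-join (y ∷ xs) z ys l₁ l₂

  linked-prefix : ∀ xs ys → Linked R (xs ++ ys) → Linked R xs
  linked-prefix []           ys l       = []
  linked-prefix (x ∷ [])     ys l       = [-]
  linked-prefix (x ∷ y ∷ xs) ys (h ∷ l) = h ∷ linked-prefix (y ∷ xs) ys l

  linked-successors : ∀ xs z → Linked R (xs ∷ʳ z) → All (λ a → ∃ (R a)) xs
  linked-successors []           z l       = []
  linked-successors (x ∷ [])     z (h ∷ l) = (z , h) ∷ []
  linked-successors (x ∷ y ∷ xs) z (h ∷ l) = (y , h) ∷ linked-successors (y ∷ xs) z l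

module _ {A : Set} where

  unique-rotate : ∀ (c : A) xs → Unique (c ∷ xs) → Unique (xs ∷ʳ c)
  unique-rotate c []       u                             = [] ∷ []
  unique-rotate c (x ∷ xs) ((c≢x ∷ c∉) ∷ (x∉ ∷ u)) = ∷ʳ⁺ x∉ (≢-sym c≢x) ∷ unique-rotate c xs (c∉ ∷ u)

  unique-++ : ∀ (xs ys : List A) → Unique xs → Unique ys → All (λ x → All (x ≢_) ys) xs → Unique (xs ++ ys)
  unique-++ []       ys u₁          u₂ d        = u₂
  unique-++ (x ∷ xs) ys (x∉ ∷ u₁) u₂ (dx ∷ d) = All-++⁺ x∉ dx ∷ unique-++ xs ys u₁ u₂ d

  length-∷ʳ : ∀ (xs : List A) z → length (xs ∷ʳ z) ≡ suc (length xs)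
  length-∷ʳ xs z = trans (length-++ xs) (+-comm (length xs) 1)

CycleAt : ∀ {k} → (Fin k → Fin k → Set) → Fin k → List (Fin k) → Set
CycleAt R h t = 2 ≤ length t × Unique (h ∷ t) × Linked R ((h ∷ t) ∷ʳ h)

rotate-cycle : ∀ {k} {R : Fin k → Fin k → Set} h d t → CycleAt R h (d ∷ t) → CycleAt R d (t ∷ʳ h)
rotate-cycle h d t (len , u , (r ∷ l)) =
  subst (2 ≤_) (sym (length-∷ʳ t h)) len , unique-rotate h (d ∷ t) u , linked-∷ʳ (d ∷ t) h d l r

sameEdge? : ∀ {k} (a b x y : Fin k) → Dec (SameEdge a b x y)
sameEdge? a b x y with a ≟ x | b ≟ y | a ≟ y | b ≟ x
... | yes a≡x | yes b≡y | _       | _       = yes (inj₁ (a≡x , b≡y))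
... | _       | _       | yes a≡y | yes b≡x = yes (inj₂ (a≡y , b≡x))
... | no a≢x  | _       | no a≢y  | _       = no λ { (inj₁ (a≡x , _)) → a≢x a≡x ; (inj₂ (a≡y , _)) → a≢y a≡y }
... | no a≢x  | _       | yes _   | no b≢x  = no λ { (inj₁ (a≡x , _)) → a≢x a≡x ; (inj₂ (_ , b≡x)) → b≢x b≡x }
... | yes _   | no b≢y  | no a≢y  | _       = no λ { (inj₁ (_ , b≡y)) → b≢y b≡y ; (inj₂ (a≡y , _)) → a≢y a≡y }
... | yes _   | no b≢y  | yes _   | no b≢x  = no λ { (inj₁ (_ , b≡y)) → b≢y b≡y ; (inj₂ (_ , b≡x)) → b≢x b≡x }

private variable
  k : ℕ
  a b x y x' y' : Fin k

SameEdge-swap : SameEdge a b x y → SameEdge b a x y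
SameEdge-swap (inj₁ (a≡x , b≡y)) = inj₂ (b≡y , a≡x)
SameEdge-swap (inj₂ (a≡y , b≡x)) = inj₁ (b≡x , a≡y)

SameEdge-sym : SameEdge a b x y → SameEdge x y a b
SameEdge-sym (inj₁ (refl , refl)) = inj₁ (refl , refl)
SameEdge-sym (inj₂ (refl , refl)) = inj₂ (refl , refl)

SameEdge-trans : SameEdge a b x y → SameEdge x y x' y' → SameEdge a b x' y'
SameEdge-trans (inj₁ (refl , refl)) s = s
SameEdge-trans (inj₂ (refl , refl)) s = SameEdge-swap s

SameEdge-map : ∀ {l} (f : Fin k → Fin l) → SameEdge a b x y → SameEdge (f a) (f b) (f x) (f y)
SameEdge-map f (inj₁ (a≡x , b≡y)) = inj₁ (cong f a≡x , cong f b≡y)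
SameEdge-map f (inj₂ (a≡y , b≡x)) = inj₂ (cong f a≡y , cong f b≡x)

SameEdge-avoids : SameEdge a b x y → y ≢ a → y ≢ b → ⊥
SameEdge-avoids (inj₁ (_ , b≡y)) y≢a y≢b = y≢b (sym b≡y)
SameEdge-avoids (inj₂ (a≡y , _)) y≢a y≢b = y≢a (sym a≡y)

module CycleLifting {m n} (R' : Fin m → Fin m → Set) (R : Fin n → Fin n → Set)
  (φ : Fin m → Fin n) (φ-injective : Injective φ) (a₀ b₀ : Fin m)
  (detour-ab detour-ba : List (Fin n))
  (map-edge  : ∀ a b → R' a b → R (φ a) (φ b) ⊎ SameEdge a b a₀ b₀)
  (path-ab   : Linked R ((φ a₀ ∷ detour-ab) ∷ʳ φ b₀))
  (path-ba   : Linked R ((φ b₀ ∷ detour-ba) ∷ʳ φ a₀))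
  (unique-ab : Unique detour-ab)
  (unique-ba : Unique detour-ba)
  (fresh-ab  : ∀ a b → R' a b → All (φ a ≢_) detour-ab)
  (fresh-ba  : ∀ a b → R' a b → All (φ a ≢_) detour-ba) where

  Special : Fin m → Fin m → Set
  Special a b = SameEdge a b a₀ b₀

  AvoidsSpecial : List (Fin m) → Set
  AvoidsSpecial (x ∷ y ∷ r) = ¬ Special x y × AvoidsSpecial (y ∷ r)
  AvoidsSpecial _           = ⊤

  ContainsSpecial : List (Fin m) → Set
  ContainsSpecial xs = Σ (List (Fin m)) λ A → Σ (Fin m) λ p → Σ (Fin m) λ q → Σ (List (Fin m)) λ B →
    xs ≡ A ++ p ∷ q ∷ B × Special p q

  special? : ∀ xs → ContainsSpecial xs ⊎ AvoidsSpecial xs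
  special? []          = inj₂ tt
  special? (x ∷ [])    = inj₂ tt
  special? (x ∷ y ∷ r) with sameEdge? x y a₀ b₀ | special? (y ∷ r)
  ... | yes s  | _                              = inj₁ ([] , x , y , r , refl , s)
  ... | no ¬s  | inj₁ (A , p , q , B , ≡A++ , s) = inj₁ (x ∷ A , p , q , B , cong (x ∷_) ≡A++ , s)
  ... | no ¬s  | inj₂ avoids                    = inj₂ (¬s , avoids)

  avoids-∷ʳ : ∀ xs p z → AvoidsSpecial (xs ∷ʳ p) → ¬ Special p z → AvoidsSpecial ((xs ∷ʳ p) ∷ʳ z)
  avoids-∷ʳ []           p z _            ¬s = ¬s , tt
  avoids-∷ʳ (x ∷ [])     p z (¬s₁ , _)    ¬s = ¬s₁ , ¬s , tt
  avoids-∷ʳ (x ∷ y ∷ xs) p z (¬s₁ , rest) ¬s = ¬s₁ , avoids-∷ʳ (y ∷ xs) p z rest ¬s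

  linked-avoiding : ∀ xs → Linked R' xs → AvoidsSpecial xs → Linked R (map φ xs)
  linked-avoiding []          l       _             = []
  linked-avoiding (x ∷ [])    l       _             = [-]
  linked-avoiding (x ∷ y ∷ r) (h ∷ l) (¬s , avoids) with map-edge x y h
  ... | inj₁ e = e ∷ linked-avoiding (y ∷ r) l avoids
  ... | inj₂ s = contradiction s ¬s

  SpecialCycle : Set
  SpecialCycle = Σ (Fin m) λ q → Σ (List (Fin m)) λ B → Σ (Fin m) λ p → CycleAt R' q (B ∷ʳ p) × Special p q

  rotate-to-special : ∀ A {h t p q B} → h ∷ t ≡ A ++ p ∷ q ∷ B → Special p q → CycleAt R' h t → SpecialCycle
  rotate-to-special []           {p = p} {q} {B} refl s c = q , B , p , rotate-cycle p q B c , s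
  rotate-to-special (a ∷ [])     {p = p} {q} {B} refl s c =
    rotate-to-special [] {p} {(q ∷ B) ∷ʳ a} {p} {q} {B ∷ʳ a} refl s (rotate-cycle a p (q ∷ B) c)
  rotate-to-special (a ∷ a' ∷ A) {p = p} {q} {B} refl s c =
    rotate-to-special (a' ∷ A) {a'} {(A ++ p ∷ q ∷ B) ∷ʳ a} {p} {q} {B ∷ʳ a}
      (cong (a' ∷_) (++-assoc A (p ∷ q ∷ B) (a ∷ []))) s (rotate-cycle a a' (A ++ p ∷ q ∷ B) c)

  module _ (q p : Fin m) (s : Special p q) where

    edge-avoiding : ∀ a b → R' a b → q ≢ a → q ≢ b → R (φ a) (φ b)
    edge-avoiding a b r q≢a q≢b with map-edge a b r
    ... | inj₁ e  = e
    ... | inj₂ s' = ⊥-elim (SameEdge-avoids (SameEdge-trans s' (SameEdge-sym s)) q≢a q≢b)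

    first-edge : ∀ b₁ → R' q b₁ → q ≢ p → b₁ ≢ p → R (φ q) (φ b₁)
    first-edge b₁ r q≢p b₁≢p with map-edge q b₁ r
    ... | inj₁ e  = e
    ... | inj₂ s' with SameEdge-trans s' (SameEdge-sym s)
    ...   | inj₁ (q≡p , _)  = contradiction q≡p q≢p
    ...   | inj₂ (_ , b₁≡p) = contradiction b₁≡p b₁≢p

    linked-not-through : ∀ xs → All (q ≢_) xs → Linked R' xs → Linked R (map φ xs)
    linked-not-through []           _                    _       = []
    linked-not-through (x ∷ [])     _                    _       = [-]
    linked-not-through (x ∷ y ∷ xs) (q≢x ∷ q≢y ∷ q∉xs) (r ∷ l) =
      edge-avoiding x y r q≢x q≢y ∷ linked-not-through (y ∷ xs) (q≢y ∷ q∉xs) l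

    -- The cycle q b₁ … p q loses its special closing edge p q; the detour P from φ p to φ q closes it again.
    splice-detour : ∀ b₁ B → CycleAt R' q ((b₁ ∷ B) ∷ʳ p) → ∀ P → Linked R ((φ p ∷ P) ∷ʳ φ q) → Unique P →
      (∀ a b → R' a b → All (φ a ≢_) P) → HasCycle R
    splice-detour b₁ B (len , u@(q∉ ∷ (b₁∉ ∷ _)) , l) P detour unique-P fresh =
      φ q , map φ body ++ P , long , unique , linked
      where
      body = (b₁ ∷ B) ∷ʳ p
      M = map φ (b₁ ∷ B)
      q≢p : q ≢ p
      q≢p = proj₂ (∷ʳ⁻ {xs = b₁ ∷ B} q∉)
      long : 2 ≤ length (map φ body ++ P)
      long = ≤-trans (subst (2 ≤_) (sym (length-map φ body)) len) (length-++-≤ˡ (map φ body))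
      unique : Unique (φ q ∷ map φ body ++ P)
      unique = unique-++ (map φ (q ∷ body)) P (Unique-map⁺ (λ {x} {y} → φ-injective x y) u) unique-P
                 (All-map⁺ (All.map (λ (b , r) → fresh _ b r) (linked-successors (q ∷ body) q l)))
      image-path : Linked R ((φ q ∷ M) ∷ʳ φ p)
      image-path with linked-prefix (q ∷ body) (q ∷ []) l
      ... | r ∷ l' = subst (Linked R) (cong (φ q ∷_) (map-++ φ (b₁ ∷ B) (p ∷ [])))
                       (first-edge b₁ r q≢p (proj₂ (∷ʳ⁻ b₁∉)) ∷ linked-not-through body q∉ l')
      rearrange : (φ q ∷ map φ body ++ P) ∷ʳ φ q ≡ (φ q ∷ M) ++ φ p ∷ (P ∷ʳ φ q)
      rearrange = cong (φ q ∷_) (begin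
        (map φ body ++ P) ++ φ q ∷ []        ≡⟨ cong (λ z → (z ++ P) ++ φ q ∷ []) (map-++ φ (b₁ ∷ B) (p ∷ [])) ⟩
        ((M ++ φ p ∷ []) ++ P) ++ φ q ∷ []   ≡⟨ ++-assoc (M ++ φ p ∷ []) P (φ q ∷ []) ⟩
        (M ++ φ p ∷ []) ++ (P ++ φ q ∷ [])   ≡⟨ ++-assoc M (φ p ∷ []) (P ++ φ q ∷ []) ⟩
        M ++ φ p ∷ (P ∷ʳ φ q)                ∎)
        where open ≡-Reasoning
      linked : Linked R ((φ q ∷ map φ body ++ P) ∷ʳ φ q)
      linked = subst (Linked R) (sym rearrange) (linked-join (φ q ∷ M) (φ p) (P ∷ʳ φ q) image-path detour)

  lift-special : SpecialCycle → HasCycle R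
  lift-special (q , [] , p , (s≤s () , _) , _)
  lift-special (q , b₁ ∷ B , p , c , s@(inj₁ (refl , refl))) = splice-detour q p s b₁ B c detour-ab path-ab unique-ab fresh-ab
  lift-special (q , b₁ ∷ B , p , c , s@(inj₂ (refl , refl))) = splice-detour q p s b₁ B c detour-ba path-ba unique-ba fresh-ba

  lift-cycle : HasCycle R' → HasCycle R
  lift-cycle (h , t , c@(len , u , l)) with special? (h ∷ t)
  ... | inj₁ (A , p , q , B , ≡A++ , s) = lift-special (rotate-to-special A ≡A++ s c)
  ... | inj₂ avoids with initLast t
  ...   | B ∷ʳ′ p with sameEdge? p h a₀ b₀
  ...     | yes s = lift-special (h , B , p , c , s)
  ...     | no ¬s = φ h , map φ (B ∷ʳ p) , subst (2 ≤_) (sym (length-map φ (B ∷ʳ p))) len ,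
                    Unique-map⁺ (λ {x} {y} → φ-injective x y) u ,
                    subst (Linked R) (map-++ φ (h ∷ B ∷ʳ p) (h ∷ []))
                      (linked-avoiding ((h ∷ B ∷ʳ p) ∷ʳ h) l (avoids-∷ʳ (h ∷ B) p h avoids ¬s))

star-preserves : ∀ {k} {R : Fin k → Fin k → Set} (P : Fin k → Set) → (∀ {a b} → P a → R a b → P b) →
  ∀ {a b} → Star R a b → P a → P b
star-preserves P closed ε        pa = pa
star-preserves P closed (r ◅ rs) pa = star-preserves P closed rs (closed pa r)

data DegreeProfile : ℕ → ℕ → ℕ → Set where
  green-3         : DegreeProfile 3 0 0
  green-2-matched : DegreeProfile 2 0 1
  green-1-cycle   : DegreeProfile 1 2 0
  cycle-matched   : DegreeProfile 0 2 1

degree-profile : ∀ {t c m} → c ≡ 0 ⊎ c ≡ 2 → m ≤ 1 → c + m + t ≡ 3 → DegreeProfile t c m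
degree-profile (inj₁ refl) z≤n       refl = green-3
degree-profile (inj₁ refl) (s≤s z≤n) refl = green-2-matched
degree-profile (inj₂ refl) z≤n       refl = green-1-cycle
degree-profile (inj₂ refl) (s≤s z≤n) refl = cycle-matched

module _ {t c m : ℕ} where

  matched-green⇒green-2 : DegreeProfile t c m → 1 ≤ m → 1 ≤ t → t ≡ 2 × c ≡ 0
  matched-green⇒green-2 green-2-matched _ _ = refl , refl
  matched-green⇒green-2 cycle-matched   _ ()

  green-2⇒matched : DegreeProfile t c m → t ≡ 2 → m ≡ 1
  green-2⇒matched green-2-matched _ = refl

  on-cycle⇒degrees : DegreeProfile t c m → 1 ≤ c → t ≤ 1 × c ≡ 2
  on-cycle⇒degrees green-1-cycle _ = s≤s z≤n , refl
  on-cycle⇒degrees cycle-matched _ = z≤n , refl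

isT-true : ∀ {l} → isT l ≡ true → l ≡ tr
isT-true {tr} _ = refl

isC-true : ∀ {l} → isC l ≡ true → l ≡ cy
isC-true {cy} _ = refl

isM-true : ∀ {l} → isM l ≡ true → l ≡ ma
isM-true {ma} _ = refl

module CubicDecomposition {n} (D : DGraph n) (cubic : Cubic D) (decomp : ThreeDecomp D) where

  L : Fin n → Fin n → Lab
  L = lab D

  L-sym : ∀ a b → L a b ≡ L b a
  L-sym = DGraph.sym D

  T-connected : ∀ u v → Star (TAdj D) u v
  T-connected = proj₁ (proj₁ decomp)

  T-acyclic : ¬ HasCycle (TAdj D)
  T-acyclic = proj₂ (proj₁ decomp)

  C-2-regular : ∀ v → deg D isC v ≡ 0 ⊎ deg D isC v ≡ 2
  C-2-regular = proj₁ (proj₂ decomp)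

  M-matching : ∀ v → deg D isM v ≤ 1
  M-matching = proj₂ (proj₂ decomp)

  profile : ∀ v → DegreeProfile (deg D isT v) (deg D isC v) (deg D isM v)
  profile v = degree-profile (C-2-regular v) (M-matching v) (begin
    deg D isC v + deg D isM v + deg D isT v   ≡⟨ +-comm (deg D isC v + deg D isM v) (deg D isT v) ⟩
    deg D isT v + (deg D isC v + deg D isM v) ≡⟨ sym (+-assoc (deg D isT v) _ _) ⟩
    deg D isT v + deg D isC v + deg D isM v   ≡⟨ sym (deg≡degT+degC+degM D v) ⟩
    deg D isEdge v                            ≡⟨ cubic v ⟩
    3                                         ∎)
    where open ≡-Reasoning

  1≤deg : ∀ p {v w} → p (L v w) ≡ true → 1 ≤ deg D p v
  1≤deg p {v} {w} pvw = subst (1 ≤_) (sym (deg≡count D p v)) (1≤count (p ∘ L v) w pvw)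

  edge⇒≢ : ∀ {a b l} → L a b ≡ l → l ≢ none → a ≢ b
  edge⇒≢ {a} ab l≢none refl = l≢none (trans (sym ab) (DGraph.irref D a))

  labels⇒≢ : ∀ {c a b l₁ l₂} → L c a ≡ l₁ → L c b ≡ l₂ → l₁ ≢ l₂ → a ≢ b
  labels⇒≢ ca cb l₁≢l₂ refl = l₁≢l₂ (trans (sym ca) cb)

  green-edge-at : ∀ w w' → w ≢ w' → ∃ λ t → L w t ≡ tr
  green-edge-at w w' w≢w' with T-connected w w'
  ... | ε     = contradiction refl w≢w'
  ... | r ◅ _ = _ , r

  T-closed⇒universal : (P : Fin n → Set) → (∀ {a b} → P a → L a b ≡ tr → P b) → ∀ {a} → P a → ∀ b → P b
  T-closed⇒universal P closed {a} pa b = star-preserves P closed (T-connected a b) pa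

  record Subdivides (w t₁ t₂ v : Fin n) : Set where
    field
      t₁≢t₂      : t₁ ≢ t₂
      green₁     : L w t₁ ≡ tr
      green₂     : L w t₂ ≡ tr
      matched    : L w v ≡ ma
      neighbours : ∀ z → L w z ≡ none ⊎ z ≡ t₁ ⊎ z ≡ t₂ ⊎ z ≡ v
      degT≡2     : deg D isT w ≡ 2

  matched⇒subdivides : ∀ {w v t} → L w v ≡ ma → L w t ≡ tr → Σ (Fin n) λ t₁ → Σ (Fin n) λ t₂ → Subdivides w t₁ t₂ v
  matched⇒subdivides {w} {v} {t} wv wt = t₁ , t₂ , record
    { t₁≢t₂ = t₁≢t₂ ; green₁ = isT-true green₁ ; green₂ = isT-true green₂
    ; matched = wv ; neighbours = neighbours ; degT≡2 = degT≡2 }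
    where
    degT≡2,degC≡0 = matched-green⇒green-2 (profile w) (1≤deg isM (cong isM wv)) (1≤deg isT (cong isT wt))
    degT≡2 = proj₁ degT≡2,degC≡0
    pair = count≡2⇒pair (isT ∘ L w) (trans (sym (deg≡count D isT w)) degT≡2)
    t₁ = proj₁ pair
    t₂ = proj₁ (proj₂ pair)
    t₁≢t₂ = proj₁ (proj₂ (proj₂ pair))
    green₁ = proj₁ (proj₂ (proj₂ (proj₂ pair)))
    green₂ = proj₁ (proj₂ (proj₂ (proj₂ (proj₂ pair))))
    neighbours : ∀ z → L w z ≡ none ⊎ z ≡ t₁ ⊎ z ≡ t₂ ⊎ z ≡ v
    neighbours z with L w z in wz
    ... | none = inj₁ refl
    ... | tr   = inj₂ (map₂ inj₁ (proj₂ (proj₂ (proj₂ (proj₂ (proj₂ pair)))) z (cong isT wz)))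
    ... | cy   = contradiction (trans (sym (cong isC wz))
                   (count≡0⇒false (isC ∘ L w) (trans (sym (deg≡count D isC w)) (proj₂ degT≡2,degC≡0)) z)) λ ()
    ... | ma   = inj₂ (inj₂ (inj₂ (count≤1⇒unique (isM ∘ L w)
                   (subst (_≤ 1) (deg≡count D isM w) (M-matching w)) (cong isM wz) (cong isM wv))))

toℕ-∨ : ∀ {p q} → ¬ (p ≡ true × q ≡ true) → toℕ (p ∨ q) ≡ toℕ p + toℕ q
toℕ-∨ {true}  {true}  ¬both = contradiction (refl , refl) ¬both
toℕ-∨ {true}  {false} _     = refl
toℕ-∨ {false} {q}     _     = refl

count-false : ∀ {n} (f : Fin n → Bool) → (∀ w → f w ≡ false) → count f ≡ 0
count-false {n} f f≡false = trans (sum-cong-≗ (cong toℕ ∘ f≡false)) (sum-replicate-zero n)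

count-≟ : ∀ {n} (c : Fin n) → count (λ w → does (w ≟ c)) ≡ 1
count-≟ {suc n} c = trans (count-punchIn (λ w → does (w ≟ c)) {c} (dec-true (c ≟ c) refl))
  (cong suc (count-false _ λ w → dec-false (punchIn c w ≟ c) (punchInᵢ≢i c w)))

does-⇔ : ∀ {A B : Set} (a? : Dec A) (b? : Dec B) → (A → B) → (B → A) → does a? ≡ does b?
does-⇔ (yes a) (yes b) _ _ = refl
does-⇔ (no ¬a) (no ¬b) _ _ = refl
does-⇔ (yes a) (no ¬b) f _ = contradiction (f a) ¬b
does-⇔ (no ¬a) (yes b) _ g = contradiction (g b) ¬a

sameEdge : ∀ {k} → Fin k → Fin k → Fin k → Fin k → Bool
sameEdge a b x y = does (sameEdge? a b x y)

sameEdge-true : ∀ {k} {a b x y : Fin k} → sameEdge a b x y ≡ true → SameEdge a b x y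
sameEdge-true {a = a} {b} {x} {y} s with sameEdge? a b x y
... | yes same = same

sameEdge-sym : ∀ {k} (a b x y : Fin k) → sameEdge a b x y ≡ sameEdge b a x y
sameEdge-sym a b x y = does-⇔ (sameEdge? a b x y) (sameEdge? b a x y) SameEdge-swap SameEdge-swap

sameEdge-irrefl : ∀ {k} (a x y : Fin k) → x ≢ y → sameEdge a a x y ≡ false
sameEdge-irrefl a x y x≢y = dec-false (sameEdge? a a x y) λ
  { (inj₁ (a≡x , a≡y)) → x≢y (trans (sym a≡x) a≡y)
  ; (inj₂ (a≡y , a≡x)) → x≢y (trans (sym a≡x) a≡y) }

count-sameEdge : ∀ {k} (a x y : Fin k) → x ≢ y →
  count (λ b → sameEdge a b x y) ≡ toℕ (does (a ≟ x)) + toℕ (does (a ≟ y))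
count-sameEdge a x y x≢y = by-cases (a ≟ x) (a ≟ y)
  where
  by-cases : (a≟x : Dec (a ≡ x)) (a≟y : Dec (a ≡ y)) → count (λ b → sameEdge a b x y) ≡ toℕ (does a≟x) + toℕ (does a≟y)
  by-cases (yes a≡x) (yes a≡y) = contradiction (trans (sym a≡x) a≡y) x≢y
  by-cases (yes a≡x) (no _)    = trans (sum-cong-≗ λ b → cong toℕ (does-⇔ (sameEdge? a b x y) (b ≟ y)
    (λ { (inj₁ (_ , b≡y)) → b≡y ; (inj₂ (a≡y , _)) → contradiction (trans (sym a≡x) a≡y) x≢y })
    (λ b≡y → inj₁ (a≡x , b≡y)))) (count-≟ y)
  by-cases (no _)    (yes a≡y) = trans (sum-cong-≗ λ b → cong toℕ (does-⇔ (sameEdge? a b x y) (b ≟ x)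
    (λ { (inj₁ (a≡x , _)) → contradiction (trans (sym a≡x) a≡y) x≢y ; (inj₂ (_ , b≡x)) → b≡x })
    (λ b≡x → inj₂ (a≡y , b≡x)))) (count-≟ x)
  by-cases (no a≢x)  (no a≢y)  = count-false _ λ b → dec-false (sameEdge? a b x y)
    λ { (inj₁ (a≡x , _)) → a≢x a≡x ; (inj₂ (a≡y , _)) → a≢y a≡y }

Reducible : ∀ {n} → DGraph n → Set
Reducible {n} D = Σ ℕ λ m → Σ (DGraph m) λ D' → m < n × Cubic D' × ThreeDecomp D' × (TutteExt D' D ⊎ DiamondExt D' D)

retract-connected : ∀ {m n} {R : Fin n → Fin n → Set} {R' : Fin m → Fin m → Set}
  (φ : Fin m → Fin n) (ρ : Fin n → Fin m) → (∀ a → ρ (φ a) ≡ a) →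
  (∀ {w w'} → R w w' → Star R' (ρ w) (ρ w')) → (∀ w w' → Star R w w') → ∀ a b → Star R' a b
retract-connected {R' = R'} φ ρ ρ∘φ map-edge connected a b =
  subst₂ (Star R') (ρ∘φ a) (ρ∘φ b) (kleisliStar ρ map-edge (connected (φ a) (φ b)))

tr≢none : tr ≢ none
tr≢none ()

ma≢none : ma ≢ none
ma≢none ()

tr≢ma : tr ≢ ma
tr≢ma ()

removed-size : ∀ {m n} (E : Embedding m n) {k} → length (Embedding.removed E) ≡ suc k → m < n
removed-size {m} E {k} ≡suc = subst (m <_) (sym (trans (size-embedding E) (cong (_+ m) ≡suc))) (s≤s (m≤n+m m k))

SameEdge-lab : ∀ {m n} (D : DGraph n) (f : Fin m → Fin n) {a b x y l} →
  SameEdge a b x y → lab D (f x) (f y) ≡ l → lab D (f a) (f b) ≡ l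
SameEdge-lab D f (inj₁ (refl , refl)) x-y = x-y
SameEdge-lab D f {x = x} {y} (inj₂ (refl , refl)) x-y = trans (DGraph.sym D (f y) (f x)) x-y

image-≢ : ∀ {m n} (f : Fin m → Fin n) {a b x y} → f a ≡ x → f b ≡ y → x ≢ y → a ≢ b
image-≢ f fa≡x fb≡y x≢y refl = x≢y (trans (sym fa≡x) fb≡y)

module TutteReduction {n} (D : DGraph n) (cubic : Cubic D) (decomp : ThreeDecomp D) {u v xu yu xv yv : Fin n}
  (su : CubicDecomposition.Subdivides D cubic decomp u xu yu v)
  (sv : CubicDecomposition.Subdivides D cubic decomp v xv yv u)
  (xu≁yu : lab D xu yu ≡ none) (xv≁yv : lab D xv yv ≡ none) where
  open CubicDecomposition D cubic decomp
  open Subdivides su using () renaming (t₁≢t₂ to xu≢yu; green₁ to u-xu; green₂ to u-yu; matched to u-v; neighbours to u-nbrs)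
  open Subdivides sv using () renaming (t₁≢t₂ to xv≢yv; green₁ to v-xv; green₂ to v-yv; matched to v-u; neighbours to v-nbrs)

  u≢v : u ≢ v
  u≢v = edge⇒≢ u-v ma≢none

  distinct-edges : ¬ SameEdge xu yu xv yv
  distinct-edges same = T-acyclic (xu , u ∷ yu ∷ v ∷ [] , s≤s (s≤s z≤n) , unique , closed-walk same)
    where
    unique : Unique (xu ∷ u ∷ yu ∷ v ∷ [])
    unique = (≢-sym (edge⇒≢ u-xu tr≢none) ∷ xu≢yu ∷ labels⇒≢ u-xu u-v tr≢ma ∷ [])
           ∷ (edge⇒≢ u-yu tr≢none ∷ u≢v ∷ []) ∷ (labels⇒≢ u-yu u-v tr≢ma ∷ []) ∷ [] ∷ []
    closed-walk : SameEdge xu yu xv yv → Linked (TAdj D) (xu ∷ u ∷ yu ∷ v ∷ xu ∷ [])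
    closed-walk (inj₁ (refl , refl)) = trans (L-sym xu u) u-xu ∷ u-yu ∷ trans (L-sym yu v) v-yv ∷ v-xv ∷ [-]
    closed-walk (inj₂ (refl , refl)) = trans (L-sym xu u) u-xu ∷ u-yu ∷ trans (L-sym yu v) v-xv ∷ v-yv ∷ [-]

  opaque
    removal : Σ ℕ λ m → Σ (Embedding m n) λ E → Embedding.removed E ≡ v ∷ u ∷ []
    removal = remove-all (v ∷ u ∷ []) ((≢-sym u≢v ∷ []) ∷ [] ∷ [])

  m = proj₁ removal
  E = proj₁ (proj₂ removal)
  open Embedding E

  removed≡ : removed ≡ v ∷ u ∷ []
  removed≡ = proj₂ (proj₂ removal)

  v∉φ : NotInImage φ v
  v∉φ = All.head (subst (All (NotInImage φ)) removed≡ removed-∉)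

  u∉φ : NotInImage φ u
  u∉φ = All.head (All.tail (subst (All (NotInImage φ)) removed≡ removed-∉))

  classify : ∀ w → InImage φ w ⊎ w ≡ u ⊎ w ≡ v
  classify w with covers w
  ... | inj₁ w∈φ = inj₁ w∈φ
  ... | inj₂ w∈ with subst (w ∈_) removed≡ w∈
  ...   | here w≡v         = inj₂ (inj₂ w≡v)
  ...   | there (here w≡u) = inj₂ (inj₁ w≡u)

  preimage : ∀ {w} → w ≢ u → w ≢ v → InImage φ w
  preimage {w} w≢u w≢v with classify w
  ... | inj₁ w∈φ         = w∈φ
  ... | inj₂ (inj₁ w≡u)  = contradiction w≡u w≢u
  ... | inj₂ (inj₂ w≡v)  = contradiction w≡v w≢v

  xu∈φ = preimage (≢-sym (edge⇒≢ u-xu tr≢none)) (labels⇒≢ u-xu u-v tr≢ma)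
  yu∈φ = preimage (≢-sym (edge⇒≢ u-yu tr≢none)) (labels⇒≢ u-yu u-v tr≢ma)
  xv∈φ = preimage (labels⇒≢ v-xv v-u tr≢ma) (≢-sym (edge⇒≢ v-xv tr≢none))
  yv∈φ = preimage (labels⇒≢ v-yv v-u tr≢ma) (≢-sym (edge⇒≢ v-yv tr≢none))
  axu = proj₁ xu∈φ
  ayu = proj₁ yu∈φ
  axv = proj₁ xv∈φ
  ayv = proj₁ yv∈φ
  φaxu≡xu = proj₂ xu∈φ
  φayu≡yu = proj₂ yu∈φ
  φaxv≡xv = proj₂ xv∈φ
  φayv≡yv = proj₂ yv∈φ

  Attachment : Fin n → Fin m → Fin m → Fin m → Set
  Attachment r ax ay a = (a ≡ ax × L r (φ a) ≡ tr) ⊎ (a ≡ ay × L r (φ a) ≡ tr) ⊎ (a ≢ ax × a ≢ ay × L r (φ a) ≡ none)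

  attachment : ∀ {r x y o ax ay} → φ ax ≡ x → φ ay ≡ y → L r x ≡ tr → L r y ≡ tr → NotInImage φ o →
    (∀ z → L r z ≡ none ⊎ z ≡ x ⊎ z ≡ y ⊎ z ≡ o) → ∀ a → Attachment r ax ay a
  attachment {r} {ax = ax} {ay} φax≡x φay≡y r-x r-y o∉φ nbrs a with nbrs (φ a)
  ... | inj₁ r≁a             = inj₂ (inj₂ ((λ { refl → tr≢none (trans (sym (subst (λ z → L r z ≡ tr) (sym φax≡x) r-x)) r≁a) })
                                         , (λ { refl → tr≢none (trans (sym (subst (λ z → L r z ≡ tr) (sym φay≡y) r-y)) r≁a) })
                                         , r≁a))
  ... | inj₂ (inj₁ φa≡x)      = inj₁ (injective a ax (trans φa≡x (sym φax≡x)) , trans (cong (L r) φa≡x) r-x)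
  ... | inj₂ (inj₂ (inj₁ φa≡y)) = inj₂ (inj₁ (injective a ay (trans φa≡y (sym φay≡y)) , trans (cong (L r) φa≡y) r-y))
  ... | inj₂ (inj₂ (inj₂ φa≡o)) = contradiction φa≡o (o∉φ a)

  attachment-green : ∀ {r ax ay a} → Attachment r ax ay a → L (φ a) r ≡ none ⊎ L (φ a) r ≡ tr
  attachment-green {r} {a = a} (inj₁ (_ , r-a))              = inj₂ (trans (L-sym (φ a) r) r-a)
  attachment-green {r} {a = a} (inj₂ (inj₁ (_ , r-a)))       = inj₂ (trans (L-sym (φ a) r) r-a)
  attachment-green {r} {a = a} (inj₂ (inj₂ (_ , _ , r≁a)))   = inj₁ (trans (L-sym (φ a) r) r≁a)

  attachment-count : ∀ {r ax ay a} → ax ≢ ay → Attachment r ax ay a →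
    toℕ (isEdge (L (φ a) r)) ≡ toℕ (does (a ≟ ax)) + toℕ (does (a ≟ ay))
  attachment-count {r} {ax} {ay} {a} ax≢ay (inj₁ (refl , r-a)) rewrite L-sym (φ a) r | r-a =
    sym (cong₂ _+_ (cong toℕ (dec-true (a ≟ a) refl)) (cong toℕ (dec-false (a ≟ ay) ax≢ay)))
  attachment-count {r} {ax} {ay} {a} ax≢ay (inj₂ (inj₁ (refl , r-a))) rewrite L-sym (φ a) r | r-a =
    sym (cong₂ _+_ (cong toℕ (dec-false (a ≟ ax) (≢-sym ax≢ay))) (cong toℕ (dec-true (a ≟ a) refl)))
  attachment-count {r} {ax} {ay} {a} ax≢ay (inj₂ (inj₂ (a≢ax , a≢ay , r≁a))) rewrite L-sym (φ a) r | r≁a =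
    sym (cong₂ _+_ (cong toℕ (dec-false (a ≟ ax) a≢ax)) (cong toℕ (dec-false (a ≟ ay) a≢ay)))

  attachment-none : ∀ {r ax ay} → (∀ a → Attachment r ax ay a) → ∀ a → a ≢ ax → a ≢ ay → L r (φ a) ≡ none
  attachment-none att a a≢ax a≢ay with att a
  ... | inj₁ (a≡ax , _)             = contradiction a≡ax a≢ax
  ... | inj₂ (inj₁ (a≡ay , _))      = contradiction a≡ay a≢ay
  ... | inj₂ (inj₂ (_ , _ , r≁a))   = r≁a

  u-attachment : ∀ a → Attachment u axu ayu a
  u-attachment = attachment φaxu≡xu φayu≡yu u-xu u-yu v∉φ u-nbrs

  v-attachment : ∀ a → Attachment v axv ayv a
  v-attachment = attachment φaxv≡xv φayv≡yv v-xv v-yv u∉φ v-nbrs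

  axu≢ayu : axu ≢ ayu
  axu≢ayu = image-≢ φ φaxu≡xu φayu≡yu xu≢yu

  axv≢ayv : axv ≢ ayv
  axv≢ayv = image-≢ φ φaxv≡xv φayv≡yv xv≢yv

  distinct-preimage-edges : ¬ SameEdge axu ayu axv ayv
  distinct-preimage-edges same = distinct-edges
    (subst₂ (λ p q → SameEdge p q xv yv) φaxu≡xu φayu≡yu
      (subst₂ (SameEdge (φ axu) (φ ayu)) φaxv≡xv φayv≡yv (SameEdge-map φ same)))

  added : Fin m → Fin m → Bool
  added a b = sameEdge a b axu ayu ∨ sameEdge a b axv ayv

  added-sym : ∀ a b → added a b ≡ added b a
  added-sym a b = cong₂ _∨_ (sameEdge-sym a b axu ayu) (sameEdge-sym a b axv ayv)

  added-irrefl : ∀ a → added a a ≡ false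
  added-irrefl a rewrite sameEdge-irrefl a axu ayu axu≢ayu | sameEdge-irrefl a axv ayv axv≢ayv = refl

  added-false : ∀ {a b} → ¬ SameEdge a b axu ayu → ¬ SameEdge a b axv ayv → added a b ≡ false
  added-false {a} {b} ¬u ¬v rewrite dec-false (sameEdge? a b axu ayu) ¬u | dec-false (sameEdge? a b axv ayv) ¬v = refl

  added-u : ∀ {a b} → SameEdge a b axu ayu → added a b ≡ true
  added-u {a} {b} s rewrite dec-true (sameEdge? a b axu ayu) s = refl

  added-v : ∀ {a b} → SameEdge a b axv ayv → added a b ≡ true
  added-v {a} {b} s rewrite dec-true (sameEdge? a b axv ayv) s with sameEdge a b axu ayu
  ... | true  = refl
  ... | false = refl

  axu≁ayu : L (φ axu) (φ ayu) ≡ none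
  axu≁ayu = subst₂ (λ p q → L p q ≡ none) (sym φaxu≡xu) (sym φayu≡yu) xu≁yu

  axv≁ayv : L (φ axv) (φ ayv) ≡ none
  axv≁ayv = subst₂ (λ p q → L p q ≡ none) (sym φaxv≡xv) (sym φayv≡yv) xv≁yv

  added⇒none : ∀ a b → added a b ≡ true → L (φ a) (φ b) ≡ none
  added⇒none a b added-ab with sameEdge a b axu ayu in su′ | sameEdge a b axv ayv in sv′
  ... | true  | _    = SameEdge-lab D φ (sameEdge-true su′) axu≁ayu
  ... | false | true = SameEdge-lab D φ (sameEdge-true sv′) axv≁ayv

  removed-green : ∀ a → All (λ r → L (φ a) r ≡ none ⊎ L (φ a) r ≡ tr) removed
  removed-green a = subst (All (λ r → L (φ a) r ≡ none ⊎ L (φ a) r ≡ tr)) (sym removed≡)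
    (attachment-green (v-attachment a) ∷ attachment-green (u-attachment a) ∷ [])

  removed-count : ∀ a → sumₗ (map (toℕ ∘ isEdge ∘ L (φ a)) removed) ≡ count (added a)
  removed-count a rewrite removed≡ = begin
    toℕ (isEdge (L (φ a) v)) + (toℕ (isEdge (L (φ a) u)) + 0)
      ≡⟨ cong₂ (λ p q → p + (q + 0)) (attachment-count axv≢ayv (v-attachment a)) (attachment-count axu≢ayu (u-attachment a)) ⟩
    Iv + (Iu + 0)                                 ≡⟨ cong (Iv +_) (+-identityʳ Iu) ⟩
    Iv + Iu                                       ≡⟨ +-comm Iv Iu ⟩
    Iu + Iv                                       ≡⟨ sym (cong₂ _+_ (count-sameEdge a axu ayu axu≢ayu) (count-sameEdge a axv ayv axv≢ayv)) ⟩
    count (λ b → sameEdge a b axu ayu) + count (λ b → sameEdge a b axv ayv)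
      ≡⟨ sym (∑-distrib-+ (λ b → toℕ (sameEdge a b axu ayu)) (λ b → toℕ (sameEdge a b axv ayv))) ⟩
    sum (λ b → toℕ (sameEdge a b axu ayu) + toℕ (sameEdge a b axv ayv))
      ≡⟨ sum-cong-≗ (λ b → sym (toℕ-∨ (not-both b))) ⟩
    count (added a)                               ∎
    where
    open ≡-Reasoning
    Iu = toℕ (does (a ≟ axu)) + toℕ (does (a ≟ ayu))
    Iv = toℕ (does (a ≟ axv)) + toℕ (does (a ≟ ayv))
    not-both : ∀ b → ¬ (sameEdge a b axu ayu ≡ true × sameEdge a b axv ayv ≡ true)
    not-both b (su′ , sv′) =
      distinct-preimage-edges (SameEdge-trans (SameEdge-sym (sameEdge-true {a = a} {b} su′)) (sameEdge-true {a = a} {b} sv′))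

  open ReducedGraph D E added added-sym added-irrefl
  open Degrees added⇒none removed-green removed-count

  ρ : Fin n → Fin m
  ρ w with classify w
  ... | inj₁ (a , _)     = a
  ... | inj₂ (inj₁ _)    = axu
  ... | inj₂ (inj₂ _)    = axv

  ρ-φ : ∀ a → ρ (φ a) ≡ a
  ρ-φ a with classify (φ a)
  ... | inj₁ (a' , φa'≡φa)    = injective a' a φa'≡φa
  ... | inj₂ (inj₁ φa≡u)      = contradiction φa≡u (u∉φ a)
  ... | inj₂ (inj₂ φa≡v)      = contradiction φa≡v (v∉φ a)

  walk-from : ∀ {r ax ay b} → (∀ a → Attachment r ax ay a) → TAdj reduced ax ay → L r (φ b) ≡ tr → Star (TAdj reduced) ax b
  walk-from {b = b} att ax-ay r-b with att b
  ... | inj₁ (refl , _)            = ε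
  ... | inj₂ (inj₁ (refl , _))     = ax-ay ◅ ε
  ... | inj₂ (inj₂ (_ , _ , r≁b))  = contradiction (trans (sym r-b) r≁b) tr≢none

  axu-ayu : TAdj reduced axu ayu
  axu-ayu = labʳ-added (added-u (inj₁ (refl , refl)))

  axv-ayv : TAdj reduced axv ayv
  axv-ayv = labʳ-added (added-v (inj₁ (refl , refl)))

  edge-ρ : ∀ {w w'} → TAdj D w w' → Star (TAdj reduced) (ρ w) (ρ w')
  edge-ρ {w} {w'} w-w' with classify w | classify w'
  ... | inj₁ (a , refl) | inj₁ (b , refl)     = labʳ-green w-w' ◅ ε
  ... | inj₁ (a , refl) | inj₂ (inj₁ refl)    = Star-reverse reduced-T-sym (walk-from u-attachment axu-ayu (trans (L-sym u (φ a)) w-w'))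
  ... | inj₁ (a , refl) | inj₂ (inj₂ refl)    = Star-reverse reduced-T-sym (walk-from v-attachment axv-ayv (trans (L-sym v (φ a)) w-w'))
  ... | inj₂ (inj₁ refl) | inj₁ (b , refl)    = walk-from u-attachment axu-ayu w-w'
  ... | inj₂ (inj₂ refl) | inj₁ (b , refl)    = walk-from v-attachment axv-ayv w-w'
  ... | inj₂ (inj₁ refl) | inj₂ (inj₁ refl)   = ε
  ... | inj₂ (inj₂ refl) | inj₂ (inj₂ refl)   = ε
  ... | inj₂ (inj₁ refl) | inj₂ (inj₂ refl)   = contradiction (trans (sym w-w') u-v) tr≢ma
  ... | inj₂ (inj₂ refl) | inj₂ (inj₁ refl)   = contradiction (trans (sym w-w') v-u) tr≢ma

  -- T with v suppressed: the green path xv v yv is replaced by the edge xv yv.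
  Tᵥ : Fin n → Fin n → Set
  Tᵥ s t = (L s t ≡ tr × s ≢ v × t ≢ v) ⊎ SameEdge s t xv yv

  reduced→Tᵥ : ∀ a b → TAdj reduced a b → Tᵥ (φ a) (φ b) ⊎ SameEdge a b axu ayu
  reduced→Tᵥ a b a-b = by-cases (sameEdge? a b axu ayu) (sameEdge? a b axv ayv)
    where
    by-cases : Dec (SameEdge a b axu ayu) → Dec (SameEdge a b axv ayv) → Tᵥ (φ a) (φ b) ⊎ SameEdge a b axu ayu
    by-cases (yes s)  _       = inj₂ s
    by-cases (no _)   (yes s) = inj₁ (inj₂ (subst₂ (SameEdge (φ a) (φ b)) φaxv≡xv φayv≡yv (SameEdge-map φ s)))
    by-cases (no ¬su) (no ¬sv) = inj₁ (inj₁ (trans (sym (labʳ-kept (added-false ¬su ¬sv))) a-b , v∉φ a , v∉φ b))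

  Tᵥ→T : ∀ s t → Tᵥ s t → TAdj D s t ⊎ SameEdge s t xv yv
  Tᵥ→T s t (inj₁ (s-t , _ , _)) = inj₁ s-t
  Tᵥ→T s t (inj₂ same)          = inj₂ same

  v-fresh : ∀ s t → Tᵥ s t → All (s ≢_) (v ∷ [])
  v-fresh s t (inj₁ (_ , s≢v , _))  = s≢v ∷ []
  v-fresh s t (inj₂ (inj₁ (refl , _))) = ≢-sym (edge⇒≢ v-xv tr≢none) ∷ []
  v-fresh s t (inj₂ (inj₂ (refl , _))) = ≢-sym (edge⇒≢ v-yv tr≢none) ∷ []

  axu-u : L (φ axu) u ≡ tr
  axu-u = trans (L-sym (φ axu) u) (subst (λ z → L u z ≡ tr) (sym φaxu≡xu) u-xu)

  ayu-u : L (φ ayu) u ≡ tr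
  ayu-u = trans (L-sym (φ ayu) u) (subst (λ z → L u z ≡ tr) (sym φayu≡yu) u-yu)

  reduced-acyclic : ¬ HasCycle (TAdj reduced)
  reduced-acyclic = T-acyclic ∘ Tᵥ-lift ∘ reduced-lift
    where
    reduced-lift = CycleLifting.lift-cycle (TAdj reduced) Tᵥ φ injective axu ayu (u ∷ []) (u ∷ []) reduced→Tᵥ
      (inj₁ (axu-u , v∉φ axu , u≢v) ∷ inj₁ (trans (L-sym u (φ ayu)) ayu-u , u≢v , v∉φ ayu) ∷ [-])
      (inj₁ (ayu-u , v∉φ ayu , u≢v) ∷ inj₁ (trans (L-sym u (φ axu)) axu-u , u≢v , v∉φ axu) ∷ [-])
      ([] ∷ []) ([] ∷ []) (λ a _ _ → u∉φ a ∷ []) (λ a _ _ → u∉φ a ∷ [])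
    Tᵥ-lift = CycleLifting.lift-cycle Tᵥ (TAdj D) id (λ _ _ → id) xv yv (v ∷ []) (v ∷ []) Tᵥ→T
      (trans (L-sym xv v) v-xv ∷ v-yv ∷ [-]) (trans (L-sym yv v) v-yv ∷ v-xv ∷ [-])
      ([] ∷ []) ([] ∷ []) v-fresh v-fresh

  extension : TutteExt reduced D
  extension = φ , u , v , axu , ayu , axv , ayv , injective , u≢v , u∉φ , v∉φ , classify
            , axu-ayu , axv-ayv , distinct-preimage-edges
            , (λ { a b (inj₁ s) → SameEdge-lab D φ s axu≁ayu ; a b (inj₂ s) → SameEdge-lab D φ s axv≁ayv })
            , (λ a b ¬su ¬sv → sym (labʳ-kept (added-false ¬su ¬sv)))
            , u-v
            , (λ { a (inj₁ refl) → trans (L-sym u (φ a)) axu-u ; a (inj₂ refl) → trans (L-sym u (φ a)) ayu-u })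
            , attachment-none u-attachment
            , (λ { a (inj₁ refl) → subst (λ z → L v z ≡ tr) (sym φaxv≡xv) v-xv
                 ; a (inj₂ refl) → subst (λ z → L v z ≡ tr) (sym φayv≡yv) v-yv })
            , attachment-none v-attachment

  reducible : Reducible D
  reducible = m , reduced , removed-size E (cong length removed≡)
            , reduced-cubic cubic
            , ((retract-connected φ ρ ρ-φ edge-ρ T-connected , reduced-acyclic) , reduced-2-regular C-2-regular , reduced-matching M-matching)
            , inj₁ extension

module DiamondReduction {n} (D : DGraph n) (cubic : Cubic D) (decomp : ThreeDecomp D) {d₁ d₂ d₃ d₄ x y : Fin n}
  (d₁-d₃ : lab D d₁ d₃ ≡ tr) (d₃-d₂ : lab D d₃ d₂ ≡ tr) (d₂-d₄ : lab D d₂ d₄ ≡ tr)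
  (d₁-d₂ : lab D d₁ d₂ ≡ ma) (d₃-d₄ : lab D d₃ d₄ ≡ ma) (d₁≁d₄ : lab D d₁ d₄ ≡ none)
  (x-d₁ : lab D x d₁ ≡ tr) (d₄-y : lab D d₄ y ≡ tr)
  (d₁-nbrs : ∀ z → lab D d₁ z ≡ none ⊎ z ≡ d₃ ⊎ z ≡ x ⊎ z ≡ d₂)
  (d₂-nbrs : ∀ z → lab D d₂ z ≡ none ⊎ z ≡ d₃ ⊎ z ≡ d₄ ⊎ z ≡ d₁)
  (d₃-nbrs : ∀ z → lab D d₃ z ≡ none ⊎ z ≡ d₂ ⊎ z ≡ d₁ ⊎ z ≡ d₄)
  (d₄-nbrs : ∀ z → lab D d₄ z ≡ none ⊎ z ≡ d₂ ⊎ z ≡ y ⊎ z ≡ d₃)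
  (x≢d₃ : x ≢ d₃) (y≢d₂ : y ≢ d₂) (x≢y : x ≢ y) (x≁y : lab D x y ≡ none) where
  open CubicDecomposition D cubic decomp

  d₁≢d₂ = edge⇒≢ d₁-d₂ ma≢none
  d₁≢d₃ = edge⇒≢ d₁-d₃ tr≢none
  d₁≢d₄ = labels⇒≢ (trans (L-sym d₂ d₁) d₁-d₂) d₂-d₄ (λ ())
  d₂≢d₃ = ≢-sym (edge⇒≢ d₃-d₂ tr≢none)
  d₂≢d₄ = edge⇒≢ d₂-d₄ tr≢none
  d₃≢d₄ = edge⇒≢ d₃-d₄ ma≢none

  opaque
    removal : Σ ℕ λ m → Σ (Embedding m n) λ E → Embedding.removed E ≡ d₄ ∷ d₃ ∷ d₂ ∷ d₁ ∷ []
    removal = remove-all (d₄ ∷ d₃ ∷ d₂ ∷ d₁ ∷ [])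
      ( (≢-sym d₃≢d₄ ∷ ≢-sym d₂≢d₄ ∷ ≢-sym d₁≢d₄ ∷ []) ∷ (≢-sym d₂≢d₃ ∷ ≢-sym d₁≢d₃ ∷ [])
      ∷ (≢-sym d₁≢d₂ ∷ []) ∷ [] ∷ [])

  m = proj₁ removal
  E = proj₁ (proj₂ removal)
  open Embedding E

  removed≡ : removed ≡ d₄ ∷ d₃ ∷ d₂ ∷ d₁ ∷ []
  removed≡ = proj₂ (proj₂ removal)

  removed∉φ : All (NotInImage φ) (d₄ ∷ d₃ ∷ d₂ ∷ d₁ ∷ [])
  removed∉φ = subst (All (NotInImage φ)) removed≡ removed-∉

  d₄∉φ = All.lookup removed∉φ (here refl)
  d₃∉φ = All.lookup removed∉φ (there (here refl))
  d₂∉φ = All.lookup removed∉φ (there (there (here refl)))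
  d₁∉φ = All.lookup removed∉φ (there (there (there (here refl))))

  Removed : Fin n → Set
  Removed w = w ≡ d₁ ⊎ w ≡ d₂ ⊎ w ≡ d₃ ⊎ w ≡ d₄

  classify : ∀ w → InImage φ w ⊎ Removed w
  classify w with covers w
  ... | inj₁ w∈φ = inj₁ w∈φ
  ... | inj₂ w∈ with subst (w ∈_) removed≡ w∈
  ...   | here w≡d₄                         = inj₂ (inj₂ (inj₂ (inj₂ w≡d₄)))
  ...   | there (here w≡d₃)                 = inj₂ (inj₂ (inj₂ (inj₁ w≡d₃)))
  ...   | there (there (here w≡d₂))         = inj₂ (inj₂ (inj₁ w≡d₂))
  ...   | there (there (there (here w≡d₁))) = inj₂ (inj₁ w≡d₁)

  removed∉image : ∀ a {w} → Removed w → φ a ≢ w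
  removed∉image a (inj₁ refl)                   = d₁∉φ a
  removed∉image a (inj₂ (inj₁ refl))            = d₂∉φ a
  removed∉image a (inj₂ (inj₂ (inj₁ refl)))     = d₃∉φ a
  removed∉image a (inj₂ (inj₂ (inj₂ refl)))     = d₄∉φ a

  preimage : ∀ {w} → ¬ Removed w → InImage φ w
  preimage {w} ¬removed with classify w
  ... | inj₁ w∈φ     = w∈φ
  ... | inj₂ removed = contradiction removed ¬removed

  x∈φ : InImage φ x
  x∈φ = preimage λ
    { (inj₁ x≡d₁)                   → edge⇒≢ x-d₁ tr≢none x≡d₁
    ; (inj₂ (inj₁ x≡d₂))            → labels⇒≢ (trans (L-sym d₁ x) x-d₁) d₁-d₂ tr≢ma x≡d₂
    ; (inj₂ (inj₂ (inj₁ x≡d₃)))     → x≢d₃ x≡d₃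
    ; (inj₂ (inj₂ (inj₂ x≡d₄)))     → labels⇒≢ (trans (L-sym d₁ x) x-d₁) d₁≁d₄ tr≢none x≡d₄ }

  y∈φ : InImage φ y
  y∈φ = preimage λ
    { (inj₁ y≡d₁)                   → labels⇒≢ d₄-y (trans (L-sym d₄ d₁) d₁≁d₄) tr≢none y≡d₁
    ; (inj₂ (inj₁ y≡d₂))            → y≢d₂ y≡d₂
    ; (inj₂ (inj₂ (inj₁ y≡d₃)))     → labels⇒≢ d₄-y (trans (L-sym d₄ d₃) d₃-d₄) tr≢ma y≡d₃
    ; (inj₂ (inj₂ (inj₂ y≡d₄)))     → edge⇒≢ d₄-y tr≢none (sym y≡d₄) }

  ax = proj₁ x∈φ
  ay = proj₁ y∈φ
  φax≡x = proj₂ x∈φ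
  φay≡y = proj₂ y∈φ

  ax≢ay : ax ≢ ay
  ax≢ay = image-≢ φ φax≡x φay≡y x≢y

  OneAttachment : Fin n → Fin m → Fin m → Set
  OneAttachment r ax a = (a ≡ ax × L r (φ a) ≡ tr) ⊎ (a ≢ ax × L r (φ a) ≡ none)

  one-attachment : ∀ {r x ax o₁ o₂} → φ ax ≡ x → L r x ≡ tr → NotInImage φ o₁ → NotInImage φ o₂ →
    (∀ z → L r z ≡ none ⊎ z ≡ o₁ ⊎ z ≡ x ⊎ z ≡ o₂) → ∀ a → OneAttachment r ax a
  one-attachment {r} {ax = ax} φax≡x r-x o₁∉φ o₂∉φ nbrs a with nbrs (φ a)
  ... | inj₁ r≁a                = inj₂ ((λ { refl → tr≢none (trans (sym (subst (λ z → L r z ≡ tr) (sym φax≡x) r-x)) r≁a) }) , r≁a)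
  ... | inj₂ (inj₁ φa≡o₁)       = contradiction φa≡o₁ (o₁∉φ a)
  ... | inj₂ (inj₂ (inj₁ φa≡x)) = inj₁ (injective a ax (trans φa≡x (sym φax≡x)) , trans (cong (L r) φa≡x) r-x)
  ... | inj₂ (inj₂ (inj₂ φa≡o₂)) = contradiction φa≡o₂ (o₂∉φ a)

  no-attachment : ∀ {r o₁ o₂ o₃} → NotInImage φ o₁ → NotInImage φ o₂ → NotInImage φ o₃ →
    (∀ z → L r z ≡ none ⊎ z ≡ o₁ ⊎ z ≡ o₂ ⊎ z ≡ o₃) → ∀ a → L r (φ a) ≡ none
  no-attachment o₁∉φ o₂∉φ o₃∉φ nbrs a with nbrs (φ a)
  ... | inj₁ r≁a                  = r≁a
  ... | inj₂ (inj₁ φa≡o₁)         = contradiction φa≡o₁ (o₁∉φ a)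
  ... | inj₂ (inj₂ (inj₁ φa≡o₂))  = contradiction φa≡o₂ (o₂∉φ a)
  ... | inj₂ (inj₂ (inj₂ φa≡o₃))  = contradiction φa≡o₃ (o₃∉φ a)

  d₁-attachment : ∀ a → OneAttachment d₁ ax a
  d₁-attachment = one-attachment φax≡x (trans (L-sym d₁ x) x-d₁) d₃∉φ d₂∉φ d₁-nbrs

  d₄-attachment : ∀ a → OneAttachment d₄ ay a
  d₄-attachment = one-attachment φay≡y d₄-y d₂∉φ d₃∉φ d₄-nbrs

  d₂-isolated : ∀ a → L d₂ (φ a) ≡ none
  d₂-isolated = no-attachment d₃∉φ d₄∉φ d₁∉φ d₂-nbrs

  d₃-isolated : ∀ a → L d₃ (φ a) ≡ none
  d₃-isolated = no-attachment d₂∉φ d₁∉φ d₄∉φ d₃-nbrs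

  one-attachment-green : ∀ {r ax a} → OneAttachment r ax a → L (φ a) r ≡ none ⊎ L (φ a) r ≡ tr
  one-attachment-green {r} {a = a} (inj₁ (_ , r-a))  = inj₂ (trans (L-sym (φ a) r) r-a)
  one-attachment-green {r} {a = a} (inj₂ (_ , r≁a))  = inj₁ (trans (L-sym (φ a) r) r≁a)

  one-attachment-count : ∀ {r ax a} → OneAttachment r ax a → toℕ (isEdge (L (φ a) r)) ≡ toℕ (does (a ≟ ax))
  one-attachment-count {r} {ax} {a} (inj₁ (a≡ax , r-a)) rewrite L-sym (φ a) r | r-a = sym (cong toℕ (dec-true (a ≟ ax) a≡ax))
  one-attachment-count {r} {ax} {a} (inj₂ (a≢ax , r≁a)) rewrite L-sym (φ a) r | r≁a = sym (cong toℕ (dec-false (a ≟ ax) a≢ax))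

  one-attachment-none : ∀ {r ax} → (∀ a → OneAttachment r ax a) → ∀ a → a ≢ ax → L r (φ a) ≡ none
  one-attachment-none att a a≢ax with att a
  ... | inj₁ (a≡ax , _) = contradiction a≡ax a≢ax
  ... | inj₂ (_ , r≁a)  = r≁a

  added : Fin m → Fin m → Bool
  added a b = sameEdge a b ax ay

  ax≁ay : L (φ ax) (φ ay) ≡ none
  ax≁ay = subst₂ (λ p q → L p q ≡ none) (sym φax≡x) (sym φay≡y) x≁y

  added⇒none : ∀ a b → added a b ≡ true → L (φ a) (φ b) ≡ none
  added⇒none a b added-ab = SameEdge-lab D φ (sameEdge-true added-ab) ax≁ay

  removed-green : ∀ a → All (λ r → L (φ a) r ≡ none ⊎ L (φ a) r ≡ tr) removed
  removed-green a = subst (All (λ r → L (φ a) r ≡ none ⊎ L (φ a) r ≡ tr)) (sym removed≡)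
    ( one-attachment-green (d₄-attachment a) ∷ inj₁ (trans (L-sym (φ a) d₃) (d₃-isolated a))
    ∷ inj₁ (trans (L-sym (φ a) d₂) (d₂-isolated a)) ∷ one-attachment-green (d₁-attachment a) ∷ [])

  removed-count : ∀ a → sumₗ (map (toℕ ∘ isEdge ∘ L (φ a)) removed) ≡ count (added a)
  removed-count a = subst (λ rs → sumₗ (map (toℕ ∘ isEdge ∘ L (φ a)) rs) ≡ count (added a)) (sym removed≡) (begin
    toℕ (isEdge (L (φ a) d₄)) + (toℕ (isEdge (L (φ a) d₃)) + (toℕ (isEdge (L (φ a) d₂)) + (toℕ (isEdge (L (φ a) d₁)) + 0)))
      ≡⟨ cong₂ (λ p q → p + (toℕ (isEdge (L (φ a) d₃)) + (toℕ (isEdge (L (φ a) d₂)) + (q + 0))))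
           (one-attachment-count (d₄-attachment a)) (one-attachment-count (d₁-attachment a)) ⟩
    Iy + (toℕ (isEdge (L (φ a) d₃)) + (toℕ (isEdge (L (φ a) d₂)) + (Ix + 0)))
      ≡⟨ cong₂ (λ p q → Iy + (toℕ (isEdge p) + (toℕ (isEdge q) + (Ix + 0))))
           (trans (L-sym (φ a) d₃) (d₃-isolated a)) (trans (L-sym (φ a) d₂) (d₂-isolated a)) ⟩
    Iy + (Ix + 0)  ≡⟨ cong (Iy +_) (+-identityʳ Ix) ⟩
    Iy + Ix        ≡⟨ +-comm Iy Ix ⟩
    Ix + Iy        ≡⟨ sym (count-sameEdge a ax ay ax≢ay) ⟩
    count (added a) ∎)
    where
    open ≡-Reasoning
    Ix = toℕ (does (a ≟ ax))
    Iy = toℕ (does (a ≟ ay))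

  open ReducedGraph D E added (λ a b → sameEdge-sym a b ax ay) (λ a → sameEdge-irrefl a ax ay ax≢ay)
  open Degrees added⇒none removed-green removed-count

  ρ-classified : ∀ {w} → InImage φ w ⊎ Removed w → Fin m
  ρ-classified (inj₁ (a , _))                 = a
  ρ-classified (inj₂ (inj₂ (inj₂ (inj₂ _))))  = ay
  ρ-classified (inj₂ _)                       = ax

  ρ : Fin n → Fin m
  ρ w = ρ-classified (classify w)

  ρ-φ : ∀ a → ρ (φ a) ≡ a
  ρ-φ a with classify (φ a)
  ... | inj₁ (a' , φa'≡φa) = injective a' a φa'≡φa
  ... | inj₂ removed       = contradiction refl (removed∉image a removed)

  Endpoint : Fin m → Set
  Endpoint a = a ≡ ax ⊎ a ≡ ay

  ρ-removed : ∀ {w} (removed : Removed w) → Endpoint (ρ-classified {w} (inj₂ removed))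
  ρ-removed (inj₁ _)                 = inj₁ refl
  ρ-removed (inj₂ (inj₁ _))          = inj₁ refl
  ρ-removed (inj₂ (inj₂ (inj₁ _)))   = inj₁ refl
  ρ-removed (inj₂ (inj₂ (inj₂ _)))   = inj₂ refl

  removed-green-neighbour : ∀ {w b} → Removed w → L w (φ b) ≡ tr → Endpoint b
  removed-green-neighbour {b = b} (inj₁ refl) w-b with d₁-attachment b
  ... | inj₁ (b≡ax , _)  = inj₁ b≡ax
  ... | inj₂ (_ , d₁≁b)  = contradiction (trans (sym w-b) d₁≁b) tr≢none
  removed-green-neighbour {b = b} (inj₂ (inj₁ refl)) w-b = contradiction (trans (sym w-b) (d₂-isolated b)) tr≢none
  removed-green-neighbour {b = b} (inj₂ (inj₂ (inj₁ refl))) w-b = contradiction (trans (sym w-b) (d₃-isolated b)) tr≢none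
  removed-green-neighbour {b = b} (inj₂ (inj₂ (inj₂ refl))) w-b with d₄-attachment b
  ... | inj₁ (b≡ay , _)  = inj₂ b≡ay
  ... | inj₂ (_ , d₄≁b)  = contradiction (trans (sym w-b) d₄≁b) tr≢none

  ax-ay : TAdj reduced ax ay
  ax-ay = labʳ-added (dec-true (sameEdge? ax ay ax ay) (inj₁ (refl , refl)))

  endpoints-connected : ∀ {p q} → Endpoint p → Endpoint q → Star (TAdj reduced) p q
  endpoints-connected (inj₁ refl) (inj₁ refl) = ε
  endpoints-connected (inj₁ refl) (inj₂ refl) = ax-ay ◅ ε
  endpoints-connected (inj₂ refl) (inj₁ refl) = reduced-T-sym ax-ay ◅ ε
  endpoints-connected (inj₂ refl) (inj₂ refl) = ε

  edge-ρ : ∀ {w w'} → TAdj D w w' → Star (TAdj reduced) (ρ w) (ρ w')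
  edge-ρ {w} {w'} w-w' with classify w | classify w'
  ... | inj₁ (a , refl) | inj₁ (b , refl) = labʳ-green w-w' ◅ ε
  ... | inj₂ r          | inj₂ r'         = endpoints-connected (ρ-removed r) (ρ-removed r')
  ... | inj₂ r          | inj₁ (b , refl) = endpoints-connected (ρ-removed r) (removed-green-neighbour r w-w')
  ... | inj₁ (a , refl) | inj₂ r'         =
    endpoints-connected (removed-green-neighbour r' (trans (L-sym w' (φ a)) w-w')) (ρ-removed r')

  kept-edge : ∀ a b → TAdj reduced a b → TAdj D (φ a) (φ b) ⊎ SameEdge a b ax ay
  kept-edge a b a-b = by-cases (sameEdge? a b ax ay)
    where
    by-cases : Dec (SameEdge a b ax ay) → TAdj D (φ a) (φ b) ⊎ SameEdge a b ax ay
    by-cases (yes s) = inj₂ s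
    by-cases (no ¬s) = inj₁ (trans (sym (labʳ-kept (dec-false (sameEdge? a b ax ay) ¬s))) a-b)

  ax-d₁ : L (φ ax) d₁ ≡ tr
  ax-d₁ = subst (λ z → L z d₁ ≡ tr) (sym φax≡x) x-d₁

  d₄-ay : L d₄ (φ ay) ≡ tr
  d₄-ay = subst (λ z → L d₄ z ≡ tr) (sym φay≡y) d₄-y

  reduced-acyclic : ¬ HasCycle (TAdj reduced)
  reduced-acyclic = T-acyclic ∘ CycleLifting.lift-cycle (TAdj reduced) (TAdj D) φ injective ax ay
    (d₁ ∷ d₃ ∷ d₂ ∷ d₄ ∷ []) (d₄ ∷ d₂ ∷ d₃ ∷ d₁ ∷ []) kept-edge
    (ax-d₁ ∷ d₁-d₃ ∷ d₃-d₂ ∷ d₂-d₄ ∷ d₄-ay ∷ [-])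
    (trans (L-sym (φ ay) d₄) d₄-ay ∷ trans (L-sym d₄ d₂) d₂-d₄ ∷ trans (L-sym d₂ d₃) d₃-d₂ ∷ trans (L-sym d₃ d₁) d₁-d₃
      ∷ trans (L-sym d₁ (φ ax)) ax-d₁ ∷ [-])
    ((d₁≢d₃ ∷ d₁≢d₂ ∷ d₁≢d₄ ∷ []) ∷ (≢-sym d₂≢d₃ ∷ d₃≢d₄ ∷ []) ∷ (d₂≢d₄ ∷ []) ∷ [] ∷ [])
    ( (≢-sym d₂≢d₄ ∷ ≢-sym d₃≢d₄ ∷ ≢-sym d₁≢d₄ ∷ []) ∷ (d₂≢d₃ ∷ ≢-sym d₁≢d₂ ∷ [])
    ∷ (≢-sym d₁≢d₃ ∷ []) ∷ [] ∷ [])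
    (λ a _ _ → d₁∉φ a ∷ d₃∉φ a ∷ d₂∉φ a ∷ d₄∉φ a ∷ [])
    (λ a _ _ → d₄∉φ a ∷ d₂∉φ a ∷ d₃∉φ a ∷ d₁∉φ a ∷ [])

  extension : DiamondExt reduced D
  extension = φ , d₁ , d₂ , d₃ , d₄ , ax , ay , injective
            , d₁≢d₂ , d₁≢d₃ , d₁≢d₄ , d₂≢d₃ , d₂≢d₄ , d₃≢d₄ , d₁∉φ , d₂∉φ , d₃∉φ , d₄∉φ
            , classify , ax-ay
            , (λ a b s → SameEdge-lab D φ s ax≁ay)
            , (λ a b ¬s → sym (labʳ-kept (dec-false (sameEdge? a b ax ay) ¬s)))
            , d₁-d₃ , d₃-d₂ , d₂-d₄ , d₁-d₂ , d₃-d₄ , d₁≁d₄ , ax-d₁ , d₄-ay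
            , one-attachment-none d₁-attachment , d₂-isolated , d₃-isolated , one-attachment-none d₄-attachment

  reducible : Reducible D
  reducible = m , reduced , removed-size E (cong length removed≡)
            , reduced-cubic cubic
            , ((retract-connected φ ρ ρ-φ edge-ρ T-connected , reduced-acyclic) , reduced-2-regular C-2-regular , reduced-matching M-matching)
            , inj₂ extension

none? : ∀ l → Dec (l ≡ none)
none? none = yes refl
none? tr   = no λ ()
none? cy   = no λ ()
none? ma   = no λ ()

swap-middle : ∀ {A B C E : Set} → A ⊎ B ⊎ C ⊎ E → A ⊎ C ⊎ B ⊎ E
swap-middle (inj₁ a)               = inj₁ a
swap-middle (inj₂ (inj₁ b))        = inj₂ (inj₂ (inj₁ b))
swap-middle (inj₂ (inj₂ (inj₁ c))) = inj₂ (inj₁ c)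
swap-middle (inj₂ (inj₂ (inj₂ e))) = inj₂ (inj₂ (inj₂ e))

module Reduce {n} (D : DGraph n) (cubic : Cubic D) (decomp : ThreeDecomp D) where
  open CubicDecomposition D cubic decomp
  open Subdivides

  swap : ∀ {w a b v} → Subdivides w a b v → Subdivides w b a v
  swap s = record { t₁≢t₂ = ≢-sym (t₁≢t₂ s) ; green₁ = green₂ s ; green₂ = green₁ s ; matched = matched s
                  ; neighbours = swap-middle ∘ neighbours s ; degT≡2 = degT≡2 s }

  other-green : ∀ {w v a} → L w v ≡ ma → L w a ≡ tr → ∃ λ b → Subdivides w a b v
  other-green {a = a} w-v w-a with matched⇒subdivides w-v w-a
  ... | t₁ , t₂ , s with neighbours s a
  ...   | inj₁ w≁a                = contradiction (trans (sym w-a) w≁a) tr≢none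
  ...   | inj₂ (inj₁ refl)        = t₂ , s
  ...   | inj₂ (inj₂ (inj₁ refl)) = t₁ , swap s
  ...   | inj₂ (inj₂ (inj₂ refl)) = contradiction (trans (sym w-a) w-v) tr≢ma

  not-neighbour : ∀ {w p₁ p₂ p₃ q} → L w q ≡ none ⊎ q ≡ p₁ ⊎ q ≡ p₂ ⊎ q ≡ p₃ →
    q ≢ p₁ → q ≢ p₂ → q ≢ p₃ → L w q ≡ none
  not-neighbour (inj₁ w≁q)               _     _     _     = w≁q
  not-neighbour (inj₂ (inj₁ q≡p₁))        q≢p₁  _     _     = contradiction q≡p₁ q≢p₁
  not-neighbour (inj₂ (inj₂ (inj₁ q≡p₂))) _     q≢p₂  _     = contradiction q≡p₂ q≢p₂
  not-neighbour (inj₂ (inj₂ (inj₂ q≡p₃))) _     _     q≢p₃  = contradiction q≡p₃ q≢p₃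

  green-leaf-on-cycle : ∀ {w a c q} → L w a ≡ tr → L w c ≡ cy → L w q ≡ tr → q ≡ a
  green-leaf-on-cycle {w} w-a w-c w-q = count≤1⇒unique (isT ∘ L w)
    (subst (_≤ 1) (deg≡count D isT w) (proj₁ (on-cycle⇒degrees (profile w) (1≤deg isC (cong isC w-c)))))
    (cong isT w-q) (cong isT w-a)

  second-cycle-neighbour : ∀ {w c} → L w c ≡ cy → ∀ t → ∃ λ c' → c' ≢ t × L w c' ≡ cy
  second-cycle-neighbour {w} w-c t
    with count≡2⇒pair (isC ∘ L w)
           (trans (sym (deg≡count D isC w)) (proj₂ (on-cycle⇒degrees (profile w) (1≤deg isC (cong isC w-c)))))
  ... | c₁ , c₂ , c₁≢c₂ , w-c₁ , w-c₂ , _ with c₁ ≟ t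
  ...   | yes refl = c₂ , ≢-sym c₁≢c₂ , isC-true w-c₂
  ...   | no c₁≢t  = c₁ , c₁≢t , isC-true w-c₁

  tutte : ∀ {u v xu yu xv yv} → Subdivides u xu yu v → Subdivides v xv yv u → L xu yu ≡ none → L xv yv ≡ none → Reducible D
  tutte = TutteReduction.reducible D cubic decomp

  module DiamondCase {u x y v w t} (su : Subdivides u x y v) (sx : Subdivides x u v y)
    (sy : Subdivides y u w x) (sv : Subdivides v x t u) where

    u≢x = edge⇒≢ (green₁ su) tr≢none
    u≢y = edge⇒≢ (green₂ su) tr≢none
    u≢v = edge⇒≢ (matched su) ma≢none
    x≢y = t₁≢t₂ su
    x≢v = labels⇒≢ (green₁ su) (matched su) tr≢ma
    y≢v = labels⇒≢ (green₂ su) (matched su) tr≢ma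
    y≢w = edge⇒≢ (green₂ sy) tr≢none
    w≢u = ≢-sym (t₁≢t₂ sy)
    w≢x = labels⇒≢ (green₂ sy) (matched sy) tr≢ma
    t≢x = ≢-sym (t₁≢t₂ sv)
    t≢u = labels⇒≢ (green₂ sv) (matched sv) tr≢ma
    t≢v = ≢-sym (edge⇒≢ (green₂ sv) tr≢none)

    w≢v : w ≢ v
    w≢v refl = T-acyclic (u , x ∷ v ∷ y ∷ [] , s≤s (s≤s z≤n)
      , ((u≢x ∷ u≢v ∷ u≢y ∷ []) ∷ (x≢v ∷ x≢y ∷ []) ∷ (≢-sym y≢v ∷ []) ∷ [] ∷ [])
      , (green₁ su ∷ green₂ sx ∷ trans (L-sym v y) (green₂ sy) ∷ green₁ sy ∷ [-]))

    y≁v : L y v ≡ none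
    y≁v = not-neighbour (neighbours sy v) (≢-sym u≢v) (≢-sym w≢v) (≢-sym x≢v)

    t≢y = labels⇒≢ (green₂ sv) (trans (L-sym v y) y≁v) tr≢none

    w≢t : w ≢ t
    w≢t refl = T-acyclic (w , y ∷ u ∷ x ∷ v ∷ [] , s≤s (s≤s z≤n)
      , ((≢-sym y≢w ∷ w≢u ∷ w≢x ∷ w≢v ∷ []) ∷ (≢-sym u≢y ∷ ≢-sym x≢y ∷ y≢v ∷ []) ∷ (u≢x ∷ u≢v ∷ []) ∷ (x≢v ∷ []) ∷ [] ∷ [])
      , (trans (L-sym w y) (green₂ sy) ∷ green₁ sy ∷ green₁ su ∷ green₂ sx ∷ green₂ sv ∷ [-]))

    u≁w = not-neighbour (neighbours su w) w≢x (≢-sym y≢w) w≢v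
    x≁w = not-neighbour (neighbours sx w) w≢u w≢v (≢-sym y≢w)
    v≁w = not-neighbour (neighbours sv w) w≢x w≢t w≢u
    u≁t = not-neighbour (neighbours su t) t≢x t≢y t≢v
    x≁t = not-neighbour (neighbours sx t) t≢u t≢v t≢y

    green-closing : L w t ≡ tr → ⊥
    green-closing w-t = T-acyclic (w , y ∷ u ∷ x ∷ v ∷ t ∷ [] , s≤s (s≤s z≤n)
      , ((≢-sym y≢w ∷ w≢u ∷ w≢x ∷ w≢v ∷ w≢t ∷ []) ∷ (≢-sym u≢y ∷ ≢-sym x≢y ∷ y≢v ∷ ≢-sym t≢y ∷ [])
        ∷ (u≢x ∷ u≢v ∷ ≢-sym t≢u ∷ []) ∷ (x≢v ∷ ≢-sym t≢x ∷ []) ∷ (≢-sym t≢v ∷ []) ∷ [] ∷ [])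
      , (trans (L-sym w y) (green₂ sy) ∷ green₁ sy ∷ green₁ su ∷ green₂ sx ∷ green₂ sv
        ∷ trans (L-sym t w) w-t ∷ [-]))

    -- The six diamond vertices would form a T-component, leaving no room for w's second C-neighbour.
    cycle-closing : L w t ≡ cy → ⊥
    cycle-closing w-t with second-cycle-neighbour w-t t
    ... | c , c≢t , w-c with T-closed⇒universal P closed (inj₁ refl) c
      where
      P : Fin n → Set
      P q = q ≡ w ⊎ q ≡ y ⊎ q ≡ u ⊎ q ≡ x ⊎ q ≡ v ⊎ q ≡ t
      from-neighbours : ∀ {a b p₁ p₂ p₃} → L a b ≡ tr → L a p₃ ≡ ma → L a b ≡ none ⊎ b ≡ p₁ ⊎ b ≡ p₂ ⊎ b ≡ p₃ → b ≡ p₁ ⊎ b ≡ p₂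
      from-neighbours a-b a-p₃ (inj₁ a≁b)               = contradiction (trans (sym a-b) a≁b) tr≢none
      from-neighbours a-b a-p₃ (inj₂ (inj₁ b≡p₁))        = inj₁ b≡p₁
      from-neighbours a-b a-p₃ (inj₂ (inj₂ (inj₁ b≡p₂))) = inj₂ b≡p₂
      from-neighbours a-b a-p₃ (inj₂ (inj₂ (inj₂ refl))) = contradiction (trans (sym a-b) a-p₃) tr≢ma
      closed : ∀ {a b} → P a → L a b ≡ tr → P b
      closed (inj₁ refl) a-b = inj₂ (inj₁ (green-leaf-on-cycle (trans (L-sym w y) (green₂ sy)) w-t a-b))
      closed {b = b} (inj₂ (inj₁ refl)) a-b with from-neighbours a-b (matched sy) (neighbours sy b)
      ... | inj₁ b≡u = inj₂ (inj₂ (inj₁ b≡u))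
      ... | inj₂ b≡w = inj₁ b≡w
      closed {b = b} (inj₂ (inj₂ (inj₁ refl))) a-b with from-neighbours a-b (matched su) (neighbours su b)
      ... | inj₁ b≡x = inj₂ (inj₂ (inj₂ (inj₁ b≡x)))
      ... | inj₂ b≡y = inj₂ (inj₁ b≡y)
      closed {b = b} (inj₂ (inj₂ (inj₂ (inj₁ refl)))) a-b with from-neighbours a-b (matched sx) (neighbours sx b)
      ... | inj₁ b≡u = inj₂ (inj₂ (inj₁ b≡u))
      ... | inj₂ b≡v = inj₂ (inj₂ (inj₂ (inj₂ (inj₁ b≡v))))
      closed {b = b} (inj₂ (inj₂ (inj₂ (inj₂ (inj₁ refl))))) a-b with from-neighbours a-b (matched sv) (neighbours sv b)
      ... | inj₁ b≡x = inj₂ (inj₂ (inj₂ (inj₁ b≡x)))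
      ... | inj₂ b≡t = inj₂ (inj₂ (inj₂ (inj₂ (inj₂ b≡t))))
      closed (inj₂ (inj₂ (inj₂ (inj₂ (inj₂ refl))))) a-b =
        inj₂ (inj₂ (inj₂ (inj₂ (inj₁ (green-leaf-on-cycle (trans (L-sym t v) (green₂ sv)) (trans (L-sym t w) w-t) a-b)))))
    ... | inj₁ refl                                       = contradiction (trans (sym w-c) (DGraph.irref D w)) λ ()
    ... | inj₂ (inj₁ refl)                                = contradiction (trans (sym w-c) (trans (L-sym w y) (green₂ sy))) λ ()
    ... | inj₂ (inj₂ (inj₁ refl))                         = contradiction (trans (sym w-c) (trans (L-sym w u) u≁w)) λ ()
    ... | inj₂ (inj₂ (inj₂ (inj₁ refl)))                  = contradiction (trans (sym w-c) (trans (L-sym w x) x≁w)) λ ()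
    ... | inj₂ (inj₂ (inj₂ (inj₂ (inj₁ refl))))           = contradiction (trans (sym w-c) (trans (L-sym w v) v≁w)) λ ()
    ... | inj₂ (inj₂ (inj₂ (inj₂ (inj₂ refl))))           = contradiction refl c≢t

    matched-closing : L w t ≡ ma → Reducible D
    matched-closing w-t
      with other-green w-t (trans (L-sym w y) (green₂ sy)) | other-green (trans (L-sym t w) w-t) (trans (L-sym t v) (green₂ sv))
    ... | s , sw | r , st = tutte sw st
      (not-neighbour (neighbours sy s) (labels⇒≢ (green₂ sw) (trans (L-sym w u) u≁w) tr≢none)
        (≢-sym (edge⇒≢ (green₂ sw) tr≢none)) (labels⇒≢ (green₂ sw) (trans (L-sym w x) x≁w) tr≢none))
      (not-neighbour (neighbours sv r) (labels⇒≢ (green₂ st) (trans (L-sym t x) x≁t) tr≢none)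
        (≢-sym (edge⇒≢ (green₂ st) tr≢none)) (labels⇒≢ (green₂ st) (trans (L-sym t u) u≁t) tr≢none))

    closing : Reducible D
    closing with L w t in w-t
    ... | none = DiamondReduction.reducible D cubic decomp
                   (green₁ sy) (green₁ su) (green₂ sx) (matched sy) (matched su) y≁v
                   (trans (L-sym w y) (green₂ sy)) (green₂ sv)
                   (neighbours sy) (neighbours sx) (neighbours su) (neighbours sv)
                   w≢u t≢x w≢t w-t
    ... | tr   = ⊥-elim (green-closing w-t)
    ... | cy   = ⊥-elim (cycle-closing w-t)
    ... | ma   = matched-closing w-t

  diamond : ∀ {u x y v w} → Subdivides u x y v → Subdivides x u v y → Subdivides y u w x → Reducible D
  diamond su sx sy = let t , sv = other-green (trans (L-sym _ _) (matched su)) (trans (L-sym _ _) (green₂ sx))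
                     in DiamondCase.closing su sx sy sv

  matched-triangle : ∀ {u x y v} → Subdivides u x y v → L x y ≡ ma → Reducible D
  matched-triangle {u} {x} {y} {v} su x-y
    with other-green x-y (trans (L-sym x u) (green₁ su)) | other-green (trans (L-sym y x) x-y) (trans (L-sym y u) (green₂ su))
  ... | z , sx | w , sy with z ≟ v | w ≟ v
  ...   | yes refl | _        = diamond su sx sy
  ...   | no _     | yes refl = diamond (swap su) sy sx
  ...   | no z≢v   | no w≢v   = tutte sx sy
    (not-neighbour (neighbours su z) (≢-sym (edge⇒≢ (green₂ sx) tr≢none)) (labels⇒≢ (green₂ sx) x-y tr≢ma) z≢v)
    (not-neighbour (neighbours su w) (labels⇒≢ (green₂ sy) (trans (L-sym y x) x-y) tr≢ma) (≢-sym (edge⇒≢ (green₂ sy) tr≢none)) w≢v)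

  green-triangle : ∀ {u x y v} → Subdivides u x y v → L x y ≡ tr → ⊥
  green-triangle {u} {x} {y} su x-y = T-acyclic (x , u ∷ y ∷ [] , s≤s (s≤s z≤n)
    , ((≢-sym (edge⇒≢ (green₁ su) tr≢none) ∷ t₁≢t₂ su ∷ []) ∷ (edge⇒≢ (green₂ su) tr≢none ∷ []) ∷ [] ∷ [])
    , (trans (L-sym x u) (green₁ su) ∷ green₂ su ∷ trans (L-sym y x) x-y ∷ [-]))

  -- x and y, being on C, are green leaves at u, so {u, x, y} would be a whole T-component.
  cycle-triangle : ∀ {u x y v} → Subdivides u x y v → L x y ≡ cy → ⊥
  cycle-triangle {u} {x} {y} {v} su x-y = v∉P (T-closed⇒universal P closed (inj₁ refl) v)
    where
    P : Fin n → Set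
    P q = q ≡ u ⊎ q ≡ x ⊎ q ≡ y
    closed : ∀ {a b} → P a → L a b ≡ tr → P b
    closed {b = b} (inj₁ refl) a-b with neighbours su b
    ... | inj₁ u≁b                = contradiction (trans (sym a-b) u≁b) tr≢none
    ... | inj₂ (inj₁ b≡x)         = inj₂ (inj₁ b≡x)
    ... | inj₂ (inj₂ (inj₁ b≡y))  = inj₂ (inj₂ b≡y)
    ... | inj₂ (inj₂ (inj₂ refl)) = contradiction (trans (sym a-b) (matched su)) tr≢ma
    closed (inj₂ (inj₁ refl)) a-b = inj₁ (green-leaf-on-cycle (trans (L-sym x u) (green₁ su)) x-y a-b)
    closed (inj₂ (inj₂ refl)) a-b = inj₁ (green-leaf-on-cycle (trans (L-sym y u) (green₂ su)) (trans (L-sym y x) x-y) a-b)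
    v∉P : ¬ P v
    v∉P (inj₁ v≡u)        = edge⇒≢ (matched su) ma≢none (sym v≡u)
    v∉P (inj₂ (inj₁ v≡x)) = labels⇒≢ (green₁ su) (matched su) tr≢ma (sym v≡x)
    v∉P (inj₂ (inj₂ v≡y)) = labels⇒≢ (green₂ su) (matched su) tr≢ma (sym v≡y)

  triangle : ∀ {u x y v} → Subdivides u x y v → L x y ≢ none → Reducible D
  triangle {x = x} {y} su x-y≢none with L x y in x-y
  ... | none = contradiction refl x-y≢none
  ... | tr   = ⊥-elim (green-triangle su x-y)
  ... | cy   = ⊥-elim (cycle-triangle su x-y)
  ... | ma   = matched-triangle su x-y

  matched-pair : ∀ {u v xu yu xv yv} → Subdivides u xu yu v → Subdivides v xv yv u → Reducible D
  matched-pair {xu = xu} {yu} {xv} {yv} su sv with none? (L xu yu) | none? (L xv yv)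
  ... | yes xu≁yu | yes xv≁yv = tutte su sv xu≁yu xv≁yv
  ... | no xu~yu  | _         = triangle su xu~yu
  ... | yes _     | no xv~yv  = triangle sv xv~yv

  HIST⊎green-2 : HIST D ⊎ ∃ λ u → deg D isT u ≡ 2
  HIST⊎green-2 with any? (λ u → deg D isT u ≟ℕ 2)
  ... | yes green-2 = inj₂ green-2
  ... | no ¬green-2 = inj₁ (proj₁ decomp , λ u degT≡2 → ¬green-2 (u , degT≡2))

  green-2-reducible : ∀ {u} → deg D isT u ≡ 2 → Reducible D
  green-2-reducible {u} degT≡2 =
    let v , u-v , _ = count≡1⇒unique (isM ∘ L u) (trans (sym (deg≡count D isM u)) (green-2⇒matched (profile u) degT≡2))
        _ , u-t     = count≡suc⇒true (isT ∘ L u) (trans (sym (deg≡count D isT u)) degT≡2)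
        v-u         = trans (L-sym v u) (isM-true u-v)
        _ , v-t     = green-edge-at v u (edge⇒≢ v-u ma≢none)
        _ , _ , su  = matched⇒subdivides (isM-true u-v) (isT-true u-t)
        _ , _ , sv  = matched⇒subdivides v-u v-t
    in matched-pair su sv

  HIST⊎reducible : HIST D ⊎ Reducible D
  HIST⊎reducible = map₂ (green-2-reducible ∘ proj₂) HIST⊎green-2

  reduce : ¬ HIST D → Reducible D
  reduce ¬hist = [ flip contradiction ¬hist , id ]′ HIST⊎reducible

  HIST⇒M-empty : HIST D → MEmpty D
  HIST⇒M-empty hist u v u-v =
    let _ , u-t = green-edge-at u v (edge⇒≢ u-v ma≢none)
        _ , _ , su = matched⇒subdivides u-v u-t
    in proj₂ hist u (degT≡2 su)

reduces-to-HIST : ∀ n → Acc _<_ n → (D : DGraph n) → Cubic D → ThreeDecomp D → ReducesToHIST D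
reduces-to-HIST n (acc smaller) D cubic decomp = [ done , reduction-step ]′ (Reduce.HIST⊎reducible D cubic decomp)
  where
  reduction-step : Reducible D → ReducesToHIST D
  reduction-step (m , D' , m<n , cubic' , decomp' , extension) =
    step D' cubic' decomp' extension (reduces-to-HIST m (smaller m<n) D' cubic' decomp')

theorem1 : ∀ (n : ℕ) (D : DGraph n) → Cubic D → ThreeDecomp D
    → (HIST D → MEmpty D)
      × (¬ HIST D → Σ ℕ λ m → Σ (DGraph m) λ D' →
           m < n × Cubic D' × ThreeDecomp D' × (TutteExt D' D ⊎ DiamondExt D' D))
      × ReducesToHIST D
theorem1 n D cubic decomp =
  Reduce.HIST⇒M-empty D cubic decomp , Reduce.reduce D cubic decomp , reduces-to-HIST n (<-wellFounded n) D cubic decomp
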